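{- The restriction of the abelianization morphism to $\operatorname{sNCQSym}$ is an algebra homomorphism $\pi:\operatorname{sNCQSym}\to\operatorname{sQSym}$, and for every set supercomposition $I$, $\pi(M_I)=M_{\alpha(I)}$.
   Context: $\mathbb{Q}^\theta\langle\langle x\rangle\rangle$: bounded-degree formal power series over $\mathbb{Q}$ in noncommuting $x_1,x_2,\ldots$ and $\theta_1,\theta_2,\ldots$ with $x_i\theta_j=\theta_jx_i$, $\theta_i\theta_j=-\theta_j\theta_i$; $\mathbb{Q}^\theta[[x]]$ is the same with the $x_i$ commuting. The abelianization morphism $\mathbb{Q}^\theta\langle\langle x\rangle\rangle\to\mathbb{Q}^\theta[[x]]$ sends each $x_i$ to its commutative counterpart and fixes each $\theta_i$. A set supercomposition of bidegree $(n,m)$ is a sequence $(I_1,\ldots,I_k)$ of nonempty subsets of $\{0,\ldots,n\}$ with $I_i\cap I_j\subseteq\{0\}$ ($i\ne j$), $\bigcup(I_i\setminus\{0\})=[n]$, $m$ blocks containing $0$ (fermionic). For a monic monomial $u$, relabel its index set order-preservingly onto $[k]$ to get $\theta_{i_1}\cdots\theta_{i_m}x_{j_1}\cdots x_{j_n}$ ($i_1<\cdots<i_m$) and set $I(u)=(I_1,\ldots,I_k)$, $I_r=\{t:j_t=r\}\cup(\{0\}$ if $r\in\{i_1,\ldots,i_m\})$; $M_I=\sum_{I(u)=I}u$. $\operatorname{sNCQSym}$ is the set of series in $\mathbb{Q}^\theta\langle\langle x\rangle\rangle$ in which monic monomials with equal standardization have equal coefficients. For $I=(I_1,\ldots,I_k)$,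 $\alpha(I)=(\alpha_1,\ldots,\alpha_k)$ with $\alpha_i=|I_i\setminus\{0\}|$ undotted if $0\notin I_i$ and dotted if $0\in I_i$. A dotted composition is a finite sequence of entries that are positive integers $a$ ($\underline\alpha_i=a,\bar\alpha_i=0$) or $\dot a$, $a\in\mathbb{N}_0$ ($\underline\alpha_i=a,\bar\alpha_i=1$); $M_\alpha=\sum_{i_1<\cdots<i_k}\theta_{i_1}^{\bar\alpha_1}\cdots\theta_{i_k}^{\bar\alpha_k}x_{i_1}^{\underline\alpha_1}\cdots x_{i_k}^{\underline\alpha_k}$. $\operatorname{sQSym}$ is the set of $f\in\mathbb{Q}^\theta[[x]]$ such that for all $a_i\in\mathbb{N}_0$, $\epsilon_i\in\{0,1\}$ with $a_i+\epsilon_i\ge1$, the coefficient of $\theta_{i_1}^{\epsilon_1}\cdots\theta_{i_k}^{\epsilon_k}x_{i_1}^{a_1}\cdots x_{i_k}^{a_k}$ is the same for all $i_1<\cdots<i_k$. -}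

module Defs where

open import Data.Nat using (ℕ; zero; suc; _≤_; _<ᵇ_; _≡ᵇ_; _≤ᵇ_)
import Data.Nat as ℕ
open import Data.Bool using (Bool; true; false; if_then_else_; T; not; _∧_)
import Data.Bool.Properties as BoolP
open import Data.List using (replicate; List; []; _∷_; _++_; map; concatMap; foldr; filter; length; zip; upTo; deduplicate; lookup; null)
import Data.List.Properties as ListP
open import Data.Product using (_×_; _,_; proj₁; proj₂; Σ; ∃)
import Data.Product.Properties as ProdP
open import Data.Fin using (Fin)
open import Data.Rational using (ℚ; 0ℚ; 1ℚ; _+_; _*_; -_)
open import Relation.Nullary using (¬_; does; ¬?)
open import Relation.Nullary.Decidable using (T?)
open import Data.Unit using (⊤)
open import Data.List.Membership.Propositional using (_∈_)
open import Data.List.Relation.Unary.All using (All)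
open import Relation.Binary.PropositionalEquality using (_≡_; _≢_)
open import Function.Bundles using (_⇔_)

-- Conventions.
-- Variables x_1, x_2, ... and θ_1, θ_2, ... are indexed by natural
-- numbers (only the order of indices matters for everything below).
--
-- A monomial of Q^θ<<x>> is written uniquely (up to a sign that is part
-- of the coefficient) as  θ_{c_1} ... θ_{c_m} x_{w_1} ... x_{w_n}  with
-- c_1 < ... < c_m ; we encode it by the pair (C , w) of lists with C
-- strictly increasing ("valid").  A series is its coefficient function
-- (values on non-valid C are junk and never inspected).
--
-- A monomial of Q^θ[[x]] is θ_{c_1}...θ_{c_m} x^{m}, encoded by
-- (C , m) with C strictly increasing and m the non-decreasing list of
-- x-indices (a multiset).

incr : List ℕ → Bool
incr [] = true
incr (x ∷ []) = true
incr (x ∷ y ∷ xs) = (x <ᵇ y) ∧ incr (y ∷ xs)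

nondecr : List ℕ → Bool
nondecr [] = true
nondecr (x ∷ []) = true
nondecr (x ∷ y ∷ xs) = (x ≤ᵇ y) ∧ nondecr (y ∷ xs)

Incr : List ℕ → Set
Incr xs = T (incr xs)

NonDecr : List ℕ → Set
NonDecr xs = T (nondecr xs)

elem : ℕ → List ℕ → Bool
elem x [] = false
elem x (y ∷ ys) = if x ≡ᵇ y then true else elem x ys

count : ℕ → List ℕ → ℕ
count x [] = 0
count x (y ∷ ys) = if x ≡ᵇ y then suc (count x ys) else count x ys

insert : ℕ → List ℕ → List ℕ
insert x [] = x ∷ []
insert x (y ∷ ys) = if x ≤ᵇ y then x ∷ y ∷ ys else y ∷ insert x ys

sortℕ : List ℕ → List ℕ
sortℕ [] = []
sortℕ (x ∷ xs) = insert x (sortℕ xs)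

sortedSet : List ℕ → List ℕ
sortedSet xs = sortℕ (deduplicate Data.Nat._≟_ xs)

eqLℕ : List ℕ → List ℕ → Bool
eqLℕ a b = does (ListP.≡-dec Data.Nat._≟_ a b)

eqLLℕ : List (List ℕ) → List (List ℕ) → Bool
eqLLℕ a b = does (ListP.≡-dec (ListP.≡-dec Data.Nat._≟_) a b)

eqDot : List (ℕ × Bool) → List (ℕ × Bool) → Bool
eqDot a b = does (ListP.≡-dec (ProdP.≡-dec Data.Nat._≟_ BoolP._≟_) a b)

sumℚ : List ℚ → ℚ
sumℚ = foldr _+_ 0ℚ

negOnePow : ℕ → ℚ
negOnePow zero = 1ℚ
negOnePow (suc n) = - negOnePow n

inversions : List ℕ → List ℕ → ℕ
inversions A B = length (concatMap (λ a → filter (λ b → b Data.Nat.<? a) B) A)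

-- θ_A θ_B = sgn A B · θ_{A ∪ B}   (A, B disjoint, strictly increasing)
sgn : List ℕ → List ℕ → ℚ
sgn A B = negOnePow (inversions A B)

subsets : List ℕ → List (List ℕ × List ℕ)
subsets [] = ([] , []) ∷ []
subsets (x ∷ xs) =
  map (λ p → (x ∷ proj₁ p , proj₂ p)) (subsets xs) ++
  map (λ p → (proj₁ p , x ∷ proj₂ p)) (subsets xs)

factorisations : List ℕ → List (List ℕ × List ℕ)
factorisations [] = ([] , []) ∷ []
factorisations (x ∷ xs) =
  ([] , x ∷ xs) ∷ map (λ p → (x ∷ proj₁ p , proj₂ p)) (factorisations xs)

subMultisets : List ℕ → List (List ℕ × List ℕ)
subMultisets m =
  deduplicate (λ p q → ListP.≡-dec Data.Nat._≟_ (proj₁ p) (proj₁ q)) (subsets m)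

words : List ℕ → ℕ → List (List ℕ)
words L zero = [] ∷ []
words L (suc n) = concatMap (λ a → map (a ∷_) (words L n)) L

NCSeries : Set
NCSeries = List ℕ → List ℕ → ℚ

_≈ₙ_ : NCSeries → NCSeries → Set
f ≈ₙ g = ∀ C w → Incr C → f C w ≡ g C w

_+ₙ_ : NCSeries → NCSeries → NCSeries
(f +ₙ g) C w = f C w + g C w

_·ₙ_ : ℚ → NCSeries → NCSeries
(c ·ₙ f) C w = c * f C w

oneₙ : NCSeries
oneₙ [] [] = 1ℚ
oneₙ _ _ = 0ℚ

-- (θ_A u)(θ_B v) = sgn A B θ_{A∪B} u v  since θ's commute with x's
_*ₙ_ : NCSeries → NCSeries → NCSeries
(f *ₙ g) C w =
  sumℚ (concatMap (λ AB → map (λ uv →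
      sgn (proj₁ AB) (proj₂ AB) * (f (proj₁ AB) (proj₁ uv) * g (proj₂ AB) (proj₂ uv)))
    (factorisations w)) (subsets C))

BoundedDegreeₙ : NCSeries → Set
BoundedDegreeₙ f = ∃ λ d → ∀ C w → Incr C → f C w ≢ 0ℚ →
  length C Data.Nat.+ length w ≤ d

-- standardization: relabel the index set order-preservingly onto [k]
indexSet : List ℕ → List ℕ → List ℕ
indexSet C w = sortedSet (C ++ w)

rank : List ℕ → ℕ → ℕ
rank S i = suc (length (filter (λ s → s Data.Nat.<? i) S))

std : List ℕ → List ℕ → List ℕ × List ℕ
std C w = map (rank (indexSet C w)) C , map (rank (indexSet C w)) w

sNCQSym : NCSeries → Set
sNCQSym f = BoundedDegreeₙ f ×
  (∀ C w C' w' → Incr C → Incr C' → std C w ≡ std C' w' → f C w ≡ f C' w')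

-- I(u) for u = θ_C x_w
-- positions t ∈ [n] (1-based) with w_t = r
positions : ℕ → List ℕ → List ℕ
positions r w =
  map proj₁ (filter (λ p → proj₂ p Data.Nat.≟ r) (zip (map suc (upTo (length w))) w))

Isc : List ℕ → List ℕ → List (List ℕ)
Isc C w =
  map (λ r → (if elem r (proj₁ (std C w)) then 0 ∷ [] else []) ++ positions r (proj₂ (std C w)))
      (map suc (upTo (length (indexSet C w))))

M : List (List ℕ) → NCSeries
M I C w = if eqLLℕ (Isc C w) I then 1ℚ else 0ℚ

-- set supercompositions of bidegree (n , m); blocks (subsets of {0..n})
-- are represented as strictly increasing lists
IsSetSupercomp : ℕ → ℕ → List (List ℕ) → Set
IsSetSupercomp n m I =
  (∀ B → B ∈ I → Incr B × B ≢ []) ×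
  (∀ (i j : Fin (length I)) → i ≢ j → ∀ x → x ∈ lookup I i → x ∈ lookup I j → x ≡ 0) ×
  (∀ (i : Fin (length I)) x → x ∈ lookup I i → x ≤ n) ×
  (∀ x → 1 ≤ x → x ≤ n → Σ (Fin (length I)) (λ i → x ∈ lookup I i)) ×
  (length (filter (λ B → T? (elem 0 B)) I) ≡ m)

-- Dotted compositions: an entry (a , false) is the undotted a (a ≥ 1),
-- (a , true) is the dotted ȧ (a ≥ 0).

DottedComp : Set
DottedComp = List (ℕ × Bool)

ValidEntry : ℕ × Bool → Set
ValidEntry (a , false) = 1 ≤ a
ValidEntry (a , true) = ⊤

α : List (List ℕ) → DottedComp
α I = map (λ B → length (filter (λ x → ¬? (x Data.Nat.≟ 0)) B) , elem 0 B) I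

CSeries : Set
CSeries = List ℕ → List ℕ → ℚ

ValidC : List ℕ → List ℕ → Set
ValidC C m = Incr C × NonDecr m

_≈c_ : CSeries → CSeries → Set
f ≈c g = ∀ C m → ValidC C m → f C m ≡ g C m

_+c_ : CSeries → CSeries → CSeries
(f +c g) C m = f C m + g C m

_·c_ : ℚ → CSeries → CSeries
(c ·c f) C m = c * f C m

onec : CSeries
onec [] [] = 1ℚ
onec _ _ = 0ℚ

_*c_ : CSeries → CSeries → CSeries
(f *c g) C m =
  sumℚ (concatMap (λ AB → map (λ uv →
      sgn (proj₁ AB) (proj₂ AB) * (f (proj₁ AB) (proj₁ uv) * g (proj₂ AB) (proj₂ uv)))
    (subMultisets m)) (subsets C))

BoundedDegreec : CSeries → Set
BoundedDegreec f = ∃ λ d → ∀ C m → ValidC C m → f C m ≢ 0ℚ →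
  length C Data.Nat.+ length m ≤ d

-- the monomial θ_{i_1}^{ε_1}⋯θ_{i_k}^{ε_k} x_{i_1}^{a_1}⋯x_{i_k}^{a_k}
-- (for i_1 < ⋯ < i_k) in normal form
monoOf : List ℕ → DottedComp → List ℕ × List ℕ
monoOf (i ∷ is) ((a , e) ∷ as) =
  (if e then i ∷ proj₁ (monoOf is as) else proj₁ (monoOf is as)) ,
  (replicate a i ++ proj₂ (monoOf is as))
monoOf _ _ = [] , []

coeffAt : CSeries → List ℕ × List ℕ → ℚ
coeffAt f (C , m) = f C m

sQSym : CSeries → Set
sQSym f = BoundedDegreec f ×
  (∀ (a : DottedComp) → All ValidEntry a → ∀ is js → Incr is → Incr js →
     length is ≡ length a → length js ≡ length a →
     coeffAt f (monoOf is a) ≡ coeffAt f (monoOf js a))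

typeC : List ℕ → List ℕ → DottedComp
typeC C m = map (λ s → count s m , elem s C) (indexSet C m)

Mc : DottedComp → CSeries
Mc a C m = if eqDot (typeC C m) a then 1ℚ else 0ℚ

abel : NCSeries → CSeries
abel f C m =
  sumℚ (map (f C) (filter (λ w → ListP.≡-dec Data.Nat._≟_ (sortℕ w) m)
                          (words (deduplicate Data.Nat._≟_ m) (length m))))

-- The coefficient of θ_C x^m in π(f) is the sum of the coefficients of f at θ_C x_w over
-- the rearrangements w of m, so π is linear, and it is multiplicative because the pairs
-- (u , v) with u v a rearrangement of m are exactly the pairs of rearrangements of two
-- complementary sub-multisets of m. An order-preserving relabelling of the variables maps
-- rearrangements bijectively onto rearrangements and preserves standardization, whence
-- quasisymmetry. For M_I: I(θ_C x_w) lists, for each variable s of the index set in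
-- increasing order, the block {0 if s ∈ C} ∪ {t | w_t = s}; hence α(I(θ_C x_w)) is the
-- exponent pattern of θ_C x^m, and w is determined by these blocks. So exactly one
-- rearrangement w of m has I(θ_C x_w) = I if α(I) is that pattern, and none otherwise.

module Submission where

open import Defs
open import Data.Nat using (ℕ; zero; suc; _≤_; _<_; _≤ᵇ_; _≡ᵇ_; z≤n; s≤s)
import Data.Nat.Properties as ℕ
open import Data.Bool using (Bool; true; false; not; if_then_else_)
import Data.Bool.Properties as Bool
open import Data.Empty using (⊥-elim)
open import Data.Fin using (Fin)
import Data.Fin as Fin
import Data.Fin.Properties as Fin
open import Data.List using (List; []; _∷_; _++_; map; concatMap; filter; length; deduplicate; replicate)
open import Data.List using (zip; upTo; lookup; cartesianProduct)
import Data.List.Properties as List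
open import Data.List.Membership.DecPropositional ℕ._≟_ using (_∈?_)
open import Data.List.Membership.Propositional using (_∈_; _∉_; find; lose)
open import Data.List.Membership.Propositional.Properties
open import Data.List.Membership.Propositional.Properties.WithK using (unique∧set⇒bag)
open import Data.List.Relation.Binary.BagAndSetEquality using (∼bag⇒↭)
open import Data.List.Relation.Binary.Disjoint.Propositional using (Disjoint)
open import Data.List.Relation.Binary.Permutation.Propositional
  using (_↭_; ↭-refl; ↭-sym; ↭-trans; ↭-prep; ↭⇒↭ₛ)
import Data.List.Relation.Binary.Permutation.Propositional.Properties as Perm
import Data.List.Relation.Binary.Permutation.Setoid.Properties as PermSetoid
open import Data.List.Relation.Binary.Pointwise using (Pointwise-≡⇒≡)
open import Data.List.Relation.Binary.Subset.Propositional using (_⊆_)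
open import Data.List.Relation.Unary.All as All using (All; []; _∷_)
import Data.List.Relation.Unary.All.Properties as All
open import Data.List.Relation.Unary.AllPairs as AllPairs using (AllPairs; []; _∷_)
import Data.List.Relation.Unary.AllPairs.Properties as AllPairs
open import Data.List.Relation.Unary.Any as Any using (here; there)
import Data.List.Relation.Unary.Any.Properties as Any
open import Data.List.Relation.Unary.Linked as Linked using (Linked; []; [-]; _∷_)
open import Data.List.Relation.Unary.Linked.Properties using (Linked⇒AllPairs; AllPairs⇒Linked)
open import Data.List.Relation.Unary.Sorted.TotalOrder ℕ.≤-totalOrder using (Sorted)
open import Data.List.Relation.Unary.Sorted.TotalOrder.Properties using (↗↭↗⇒≋)
open import Data.List.Relation.Unary.Unique.Propositional using (Unique)
import Data.List.Relation.Unary.Unique.Propositional.Properties as Uniqueₚ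
import Data.List.Relation.Unary.Unique.DecPropositional.Properties ℕ._≟_ as Uniqueℕ
import Data.List.Relation.Unary.Unique.DecSetoid.Properties as UniqueDecSetoid
import Data.List.Sort.InsertionSort ℕ.≤-decTotalOrder as InsertionSort
import Data.List.Sort.InsertionSort.Properties ℕ.≤-decTotalOrder as InsertionSortₚ
open import Data.Product using (_×_; _,_; proj₁; proj₂; ∃-syntax)
import Data.Product.Properties as Product
open import Data.Rational using (ℚ; 0ℚ; 1ℚ; _+_; _*_)
import Data.Rational.Properties as ℚ
open import Algebra.Bundles using (CommutativeMonoid)
open import Algebra.Properties.CommutativeSemigroup
  (CommutativeMonoid.commutativeSemigroup ℚ.+-0-commutativeMonoid)
  using () renaming (interchange to +-interchange)
open import Data.Sum using (inj₁; inj₂; [_,_]′)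
open import Function using (_∘_; _⇔_; mk⇔; Equivalence)
import Relation.Binary.Construct.On as On
open import Relation.Binary.Definitions using (tri<; tri≈; tri>)
open import Relation.Binary.PropositionalEquality
open import Relation.Binary.PropositionalEquality.Properties using (decSetoid)
open import Relation.Nullary using (Dec; yes; no; does)
open import Relation.Nullary.Decidable using (does-⇔; dec-true; dec-false; ¬?)
open import Relation.Unary using (Decidable)

private variable
  A B : Set

sumℚ-++ : ∀ xs ys → sumℚ (xs ++ ys) ≡ sumℚ xs + sumℚ ys
sumℚ-++ [] ys = sym (ℚ.+-identityˡ _)
sumℚ-++ (x ∷ xs) ys = trans (cong (x +_) (sumℚ-++ xs ys)) (sym (ℚ.+-assoc x _ _))

sumℚ-↭ : ∀ {xs ys} → xs ↭ ys → sumℚ xs ≡ sumℚ ys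
sumℚ-↭ p = PermSetoid.foldr-commMonoid (setoid ℚ) ℚ.+-0-isCommutativeMonoid (↭⇒↭ₛ p)

sumℚ-cong : ∀ (F G : A → ℚ) xs → (∀ {x} → x ∈ xs → F x ≡ G x) → sumℚ (map F xs) ≡ sumℚ (map G xs)
sumℚ-cong F G xs F≗G = cong sumℚ (List.map-cong-local (All.tabulate F≗G))

sumℚ-zero : ∀ (F : A → ℚ) xs → (∀ {x} → x ∈ xs → F x ≡ 0ℚ) → sumℚ (map F xs) ≡ 0ℚ
sumℚ-zero F [] _ = refl
sumℚ-zero F (x ∷ xs) F≡0 = cong₂ _+_ (F≡0 (here refl)) (sumℚ-zero F xs (F≡0 ∘ there))

sumℚ-map-+ : ∀ (F G : A → ℚ) xs →
  sumℚ (map (λ x → F x + G x) xs) ≡ sumℚ (map F xs) + sumℚ (map G xs)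
sumℚ-map-+ F G [] = refl
sumℚ-map-+ F G (x ∷ xs) =
  trans (cong ((F x + G x) +_) (sumℚ-map-+ F G xs)) (+-interchange (F x) (G x) _ _)

sumℚ-map-*ˡ : ∀ c (F : A → ℚ) xs → sumℚ (map (λ x → c * F x) xs) ≡ c * sumℚ (map F xs)
sumℚ-map-*ˡ c F [] = sym (ℚ.*-zeroʳ c)
sumℚ-map-*ˡ c F (x ∷ xs) =
  trans (cong (c * F x +_) (sumℚ-map-*ˡ c F xs)) (sym (ℚ.*-distribˡ-+ c (F x) _))

sumℚ-concatMap : ∀ (f : A → List ℚ) xs → sumℚ (concatMap f xs) ≡ sumℚ (map (sumℚ ∘ f) xs)
sumℚ-concatMap f [] = refl
sumℚ-concatMap f (x ∷ xs) = trans (sumℚ-++ (f x) _) (cong (sumℚ (f x) +_) (sumℚ-concatMap f xs))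

sumℚ-map-concatMap : ∀ (F : B → ℚ) (f : A → List B) xs →
  sumℚ (map F (concatMap f xs)) ≡ sumℚ (map (λ x → sumℚ (map F (f x))) xs)
sumℚ-map-concatMap F f xs = trans (cong sumℚ (List.map-concatMap F f xs)) (sumℚ-concatMap (map F ∘ f) xs)

sumℚ-comm : ∀ (F : A → B → ℚ) xs ys →
  sumℚ (map (λ x → sumℚ (map (F x) ys)) xs) ≡ sumℚ (map (λ y → sumℚ (map (λ x → F x y) xs)) ys)
sumℚ-comm F [] ys = sym (sumℚ-zero _ ys (λ _ → refl))
sumℚ-comm F (x ∷ xs) ys =
  trans (cong (sumℚ (map (F x) ys) +_) (sumℚ-comm F xs ys))
        (sym (sumℚ-map-+ (F x) (λ y → sumℚ (map (λ x → F x y) xs)) ys))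

sumℚ-cartesianProduct : ∀ c (F : A → ℚ) (G : B → ℚ) xs ys →
  sumℚ (map (λ p → c * (F (proj₁ p) * G (proj₂ p))) (cartesianProduct xs ys)) ≡
  c * (sumℚ (map F xs) * sumℚ (map G ys))
sumℚ-cartesianProduct c F G [] ys = sym (trans (cong (c *_) (ℚ.*-zeroˡ (sumℚ (map G ys)))) (ℚ.*-zeroʳ c))
sumℚ-cartesianProduct c F G (x ∷ xs) ys = begin
  sumℚ (map H (map (x ,_) ys ++ cartesianProduct xs ys))
    ≡⟨ cong sumℚ (List.map-++ H (map (x ,_) ys) _) ⟩
  sumℚ (map H (map (x ,_) ys) ++ map H (cartesianProduct xs ys))
    ≡⟨ sumℚ-++ (map H (map (x ,_) ys)) _ ⟩
  sumℚ (map H (map (x ,_) ys)) + sumℚ (map H (cartesianProduct xs ys))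
    ≡⟨ cong₂ _+_ (cong sumℚ (sym (List.map-∘ ys))) (sumℚ-cartesianProduct c F G xs ys) ⟩
  sumℚ (map (λ y → c * (F x * G y)) ys) + c * (sumℚ (map F xs) * ΣG)
    ≡⟨ cong (_+ c * (sumℚ (map F xs) * ΣG))
            (trans (sumℚ-map-*ˡ c _ ys) (cong (c *_) (sumℚ-map-*ˡ (F x) G ys))) ⟩
  c * (F x * ΣG) + c * (sumℚ (map F xs) * ΣG)
    ≡⟨ ℚ.*-distribˡ-+ c _ _ ⟨
  c * (F x * ΣG + sumℚ (map F xs) * ΣG)
    ≡⟨ cong (c *_) (ℚ.*-distribʳ-+ ΣG (F x) _) ⟨
  c * ((F x + sumℚ (map F xs)) * ΣG) ∎
  where
  open ≡-Reasoning
  H = λ p → c * (F (proj₁ p) * G (proj₂ p))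
  ΣG = sumℚ (map G ys)

sumℚ-nonzero : ∀ (F : A → ℚ) xs → sumℚ (map F xs) ≢ 0ℚ → ∃[ x ] x ∈ xs × F x ≢ 0ℚ
sumℚ-nonzero F [] Σ≢0 = ⊥-elim (Σ≢0 refl)
sumℚ-nonzero F (x ∷ xs) Σ≢0 with F x Data.Rational.≟ 0ℚ
... | no Fx≢0 = x , here refl , Fx≢0
... | yes Fx≡0 with sumℚ-nonzero F xs (λ Σ≡0 → Σ≢0 (cong₂ _+_ Fx≡0 Σ≡0))
...   | y , y∈ , Fy≢0 = y , there y∈ , Fy≢0

sumℚ-indicator : ∀ (F : A → ℚ) xs {x₀} → Unique xs → x₀ ∈ xs → F x₀ ≡ 1ℚ →
  (∀ {x} → x ∈ xs → x ≢ x₀ → F x ≡ 0ℚ) → sumℚ (map F xs) ≡ 1ℚ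
sumℚ-indicator F (x ∷ xs) (x∉ ∷ _) (here refl) F₀≡1 F≡0 =
  cong₂ _+_ F₀≡1 (sumℚ-zero F xs (λ y∈ → F≡0 (there y∈) (λ y≡x → All.lookup x∉ y∈ (sym y≡x))))
sumℚ-indicator F (x ∷ xs) (x∉ ∷ u) (there x₀∈) F₀≡1 F≡0 =
  trans (cong₂ _+_ (F≡0 (here refl) (λ x≡x₀ → All.lookup x∉ x₀∈ x≡x₀))
                   (sumℚ-indicator F xs u x₀∈ F₀≡1 (F≡0 ∘ there)))
        (ℚ.+-identityˡ 1ℚ)

Unique-concatMap : ∀ (f : A → List B) {xs} → AllPairs (λ x y → Disjoint (f x) (f y)) xs →
  All (Unique ∘ f) xs → Unique (concatMap f xs)
Unique-concatMap f disjoint unique = Uniqueₚ.concat⁺ (All.map⁺ unique) (AllPairs.map⁺ disjoint)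

↭-from-members : ∀ {xs ys : List A} → Unique xs → Unique ys → (∀ {z} → z ∈ xs ⇔ z ∈ ys) → xs ↭ ys
↭-from-members u v xs≈ys = ∼bag⇒↭ (unique∧set⇒bag u v xs≈ys)

↭-++-cancelˡ : ∀ (xs : List A) {ys zs} → xs ++ ys ↭ xs ++ zs → ys ↭ zs
↭-++-cancelˡ [] p = p
↭-++-cancelˡ (x ∷ xs) p = ↭-++-cancelˡ xs (Perm.drop-∷ p)

filter-map : ∀ {P : B → Set} {Q : A → Set} (P? : Decidable P) (Q? : Decidable Q) (h : A → B) xs →
  (∀ {x} → x ∈ xs → does (P? (h x)) ≡ does (Q? x)) → filter P? (map h xs) ≡ map h (filter Q? xs)
filter-map P? Q? h [] _ = refl
filter-map P? Q? h (x ∷ xs) agree with P? (h x) | Q? x | agree (here refl)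
... | yes _ | yes _ | _ = cong (h x ∷_) (filter-map P? Q? h xs (agree ∘ there))
... | no _  | no _  | _ = filter-map P? Q? h xs (agree ∘ there)

map-cong-local⁻ : ∀ {f g : A → B} xs → map f xs ≡ map g xs → ∀ {x} → x ∈ xs → f x ≡ g x
map-cong-local⁻ (x ∷ xs) eq (here refl) = List.∷-injectiveˡ eq
map-cong-local⁻ (x ∷ xs) eq (there x∈) = map-cong-local⁻ xs (List.∷-injectiveʳ eq) x∈

map-proj₁-zip : ∀ (xs : List A) (ys : List B) → length xs ≡ length ys → map proj₁ (zip xs ys) ≡ xs
map-proj₁-zip [] [] _ = refl
map-proj₁-zip (x ∷ xs) (y ∷ ys) eq = cong (x ∷_) (map-proj₁-zip xs ys (ℕ.suc-injective eq))

map-proj₂-zip : ∀ (xs : List A) (ys : List B) → length xs ≡ length ys → map proj₂ (zip xs ys) ≡ ys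
map-proj₂-zip [] [] _ = refl
map-proj₂-zip (x ∷ xs) (y ∷ ys) eq = cong (y ∷_) (map-proj₂-zip xs ys (ℕ.suc-injective eq))

functional-pairs : ∀ {P : List (A × B)} {a b b′} →
  Unique (map proj₁ P) → (a , b) ∈ P → (a , b′) ∈ P → b ≡ b′
functional-pairs _ (here refl) (here refl) = refl
functional-pairs (a∉ ∷ _) (here refl) (there ab′∈) = ⊥-elim (All.lookup a∉ (∈-map⁺ proj₁ ab′∈) refl)
functional-pairs (a∉ ∷ _) (there ab∈) (here refl) = ⊥-elim (All.lookup a∉ (∈-map⁺ proj₁ ab∈) refl)
functional-pairs (_ ∷ P!) (there ab∈) (there ab′∈) = functional-pairs P! ab∈ ab′∈

count-∷-≡ : ∀ x u → count x (x ∷ u) ≡ suc (count x u)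
count-∷-≡ x u = cong (λ b → if b then suc (count x u) else count x u) (dec-true (x ℕ.≟ x) refl)

count-∷-≢ : ∀ {x r} u → r ≢ x → count r (x ∷ u) ≡ count r u
count-∷-≢ {x} {r} u r≢x = cong (λ b → if b then suc (count r u) else count r u) (dec-false (r ℕ.≟ x) r≢x)

count≡length-filter : ∀ x ys → count x ys ≡ length (filter (x ℕ.≟_) ys)
count≡length-filter x [] = refl
count≡length-filter x (y ∷ ys) with x ≡ᵇ y
... | true = cong suc (count≡length-filter x ys)
... | false = count≡length-filter x ys

count-↭ : ∀ x {ys zs} → ys ↭ zs → count x ys ≡ count x zs
count-↭ x {ys} {zs} ys↭zs = begin
  count x ys                      ≡⟨ count≡length-filter x ys ⟩
  length (filter (x ℕ.≟_) ys)     ≡⟨ Perm.↭-length (Perm.filter-↭ (x ℕ.≟_) ys↭zs) ⟩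
  length (filter (x ℕ.≟_) zs)     ≡⟨ count≡length-filter x zs ⟨
  count x zs                      ∎
  where open ≡-Reasoning

count-∉ : ∀ {x} ys → x ∉ ys → count x ys ≡ 0
count-∉ {x} ys x∉ = trans (count≡length-filter x ys)
  (cong length (List.filter-none (x ℕ.≟_) (All.tabulate (λ y∈ x≡y → x∉ (subst (_∈ ys) (sym x≡y) y∈)))))

count-∷-cancel : ∀ y x as bs → count y (x ∷ as) ≡ count y (x ∷ bs) → count y as ≡ count y bs
count-∷-cancel y x as bs eq with y ℕ.≟ x
... | yes refl = ℕ.suc-injective (trans (sym (count-∷-≡ y as)) (trans eq (count-∷-≡ y bs)))
... | no y≢x = trans (sym (count-∷-≢ as y≢x)) (trans eq (count-∷-≢ bs y≢x))

same-count⇒↭ : ∀ xs ys → (∀ z → count z xs ≡ count z ys) → xs ↭ ys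
same-count⇒↭ [] [] _ = ↭-refl
same-count⇒↭ [] (y ∷ ys) same = ⊥-elim (ℕ.0≢1+n (trans (same y) (count-∷-≡ y ys)))
same-count⇒↭ (x ∷ xs) ys same with x ∈? ys
... | no x∉ = ⊥-elim (ℕ.1+n≢0 (trans (sym (count-∷-≡ x xs)) (trans (same x) (count-∉ ys x∉))))
... | yes x∈ with ∈-∃++ x∈
...   | ys₁ , ys₂ , refl =
  ↭-trans (↭-prep x (same-count⇒↭ xs (ys₁ ++ ys₂) same-tail)) (↭-sym (Perm.shift x ys₁ ys₂))
  where
  same-tail : ∀ z → count z xs ≡ count z (ys₁ ++ ys₂)
  same-tail z = count-∷-cancel z x xs (ys₁ ++ ys₂) (trans (same z) (count-↭ z (Perm.shift x ys₁ ys₂)))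

elem-∈ : ∀ {x ys} → x ∈ ys → elem x ys ≡ true
elem-∈ {x} {_ ∷ ys} (here refl) = cong (λ b → if b then true else elem x ys) (dec-true (x ℕ.≟ x) refl)
elem-∈ {x} {y ∷ _} (there x∈) with x ≡ᵇ y
... | true = refl
... | false = elem-∈ x∈

elem-∉ : ∀ {x} ys → x ∉ ys → elem x ys ≡ false
elem-∉ [] _ = refl
elem-∉ {x} (y ∷ ys) x∉ =
  trans (cong (λ b → if b then true else elem x ys) (dec-false (x ℕ.≟ y) (x∉ ∘ here)))
        (elem-∉ ys (x∉ ∘ there))

insert≡InsertionSort-insert : ∀ x xs → insert x xs ≡ InsertionSort.insert x xs
insert≡InsertionSort-insert x [] = refl
insert≡InsertionSort-insert x (y ∷ ys) with x ≤ᵇ y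
... | true = refl
... | false = cong (y ∷_) (insert≡InsertionSort-insert x ys)

sortℕ≡InsertionSort-sort : ∀ xs → sortℕ xs ≡ InsertionSort.sort xs
sortℕ≡InsertionSort-sort [] = refl
sortℕ≡InsertionSort-sort (x ∷ xs) =
  trans (cong (insert x) (sortℕ≡InsertionSort-sort xs))
        (insert≡InsertionSort-insert x (InsertionSort.sort xs))

sortℕ-↭ : ∀ xs → sortℕ xs ↭ xs
sortℕ-↭ xs = subst (_↭ xs) (sym (sortℕ≡InsertionSort-sort xs)) (InsertionSortₚ.sort-↭ xs)

sortℕ-↗ : ∀ xs → Sorted (sortℕ xs)
sortℕ-↗ xs = subst Sorted (sym (sortℕ≡InsertionSort-sort xs)) (InsertionSortₚ.sort-↗ xs)

↗↭↗⇒≡ : ∀ {xs ys} → Sorted xs → Sorted ys → xs ↭ ys → xs ≡ ys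
↗↭↗⇒≡ xs↗ ys↗ xs↭ys = Pointwise-≡⇒≡ (↗↭↗⇒≋ ℕ.≤-totalOrder xs↗ ys↗ (↭⇒↭ₛ xs↭ys))

sortℕ-cong-↭ : ∀ {xs ys} → xs ↭ ys → sortℕ xs ≡ sortℕ ys
sortℕ-cong-↭ {xs} {ys} xs↭ys = ↗↭↗⇒≡ (sortℕ-↗ xs) (sortℕ-↗ ys)
  (↭-trans (sortℕ-↭ xs) (↭-trans xs↭ys (↭-sym (sortℕ-↭ ys))))

sortℕ-↗-id : ∀ {xs} → Sorted xs → sortℕ xs ≡ xs
sortℕ-↗-id {xs} xs↗ = ↗↭↗⇒≡ (sortℕ-↗ xs) xs↗ (sortℕ-↭ xs)

NonDecr⇒Sorted : ∀ xs → NonDecr xs → Sorted xs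
NonDecr⇒Sorted [] _ = []
NonDecr⇒Sorted (x ∷ []) _ = [-]
NonDecr⇒Sorted (x ∷ y ∷ xs) h =
  let x≤y , rest = Equivalence.to Bool.T-∧ h in ℕ.≤ᵇ⇒≤ x y x≤y ∷ NonDecr⇒Sorted (y ∷ xs) rest

Sorted-head : ∀ {x xs} → Sorted (x ∷ xs) → ∀ {z} → z ∈ x ∷ xs → x ≤ z
Sorted-head _ (here refl) = ℕ.≤-refl
Sorted-head x∷xs↗ (there z∈) = All.lookup (AllPairs.head (Linked⇒AllPairs ℕ.≤-trans x∷xs↗)) z∈

Sorted-∷ : ∀ {x xs} → (∀ {z} → z ∈ xs → x ≤ z) → Sorted xs → Sorted (x ∷ xs)
Sorted-∷ {xs = []} _ _ = [-]
Sorted-∷ {xs = _ ∷ _} x≤ xs↗ = x≤ (here refl) ∷ xs↗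

Incr⇒Linked : ∀ xs → Incr xs → Linked _<_ xs
Incr⇒Linked [] _ = []
Incr⇒Linked (x ∷ []) _ = [-]
Incr⇒Linked (x ∷ y ∷ xs) h =
  let x<y , rest = Equivalence.to Bool.T-∧ h in ℕ.<ᵇ⇒< x y x<y ∷ Incr⇒Linked (y ∷ xs) rest

Linked⇒Incr : ∀ {xs} → Linked _<_ xs → Incr xs
Linked⇒Incr [] = _
Linked⇒Incr [-] = _
Linked⇒Incr (x<y ∷ h) = Equivalence.from Bool.T-∧ (ℕ.<⇒<ᵇ x<y , Linked⇒Incr h)

Incr⇒AllPairs : ∀ {xs} → Incr xs → AllPairs _<_ xs
Incr⇒AllPairs {xs} h = Linked⇒AllPairs ℕ.<-trans (Incr⇒Linked xs h)

AllPairs⇒Incr : ∀ {xs} → AllPairs _<_ xs → Incr xs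
AllPairs⇒Incr h = Linked⇒Incr (AllPairs⇒Linked h)

strict⇒unique : ∀ {xs} → AllPairs _<_ xs → Unique xs
strict⇒unique = AllPairs.map ℕ.<⇒≢

strict⇒sorted : ∀ {xs} → AllPairs _<_ xs → Sorted xs
strict⇒sorted h = AllPairs⇒Linked (AllPairs.map ℕ.<⇒≤ h)

sorted∧unique⇒strict : ∀ {xs} → Sorted xs → Unique xs → AllPairs _<_ xs
sorted∧unique⇒strict xs↗ u =
  AllPairs.zipWith (λ (x≤y , x≢y) → ℕ.≤∧≢⇒< x≤y x≢y) (Linked⇒AllPairs ℕ.≤-trans xs↗ , u)

strict-≡ : ∀ {xs ys} → AllPairs _<_ xs → AllPairs _<_ ys → (∀ {z} → z ∈ xs ⇔ z ∈ ys) → xs ≡ ys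
strict-≡ xs< ys< xs≈ys = ↗↭↗⇒≡ (strict⇒sorted xs<) (strict⇒sorted ys<)
  (↭-from-members (strict⇒unique xs<) (strict⇒unique ys<) xs≈ys)

sortedSet-strict : ∀ xs → AllPairs _<_ (sortedSet xs)
sortedSet-strict xs = sorted∧unique⇒strict (sortℕ-↗ (deduplicate ℕ._≟_ xs))
  (PermSetoid.Unique-resp-↭ (setoid ℕ) (↭⇒↭ₛ (↭-sym (sortℕ-↭ _))) (Uniqueℕ.deduplicate-! xs))

∈-sortedSet : ∀ xs {x} → x ∈ sortedSet xs ⇔ x ∈ xs
∈-sortedSet xs = mk⇔
  (λ x∈ → ∈-deduplicate⁻ ℕ._≟_ xs (Perm.∈-resp-↭ (sortℕ-↭ _) x∈))
  (λ x∈ → Perm.∈-resp-↭ (↭-sym (sortℕ-↭ _)) (∈-deduplicate⁺ ℕ._≟_ x∈))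

oneTo : ℕ → List ℕ
oneTo n = map suc (upTo n)

∈-oneTo⁺ : ∀ {n t} → 1 ≤ t → t ≤ n → t ∈ oneTo n
∈-oneTo⁺ {t = suc i} _ i<n = ∈-map⁺ suc (∈-upTo⁺ i<n)

∈-oneTo⁻ : ∀ {n t} → t ∈ oneTo n → 1 ≤ t × t ≤ n
∈-oneTo⁻ t∈ with ∈-map⁻ suc t∈
... | i , i∈ , refl = s≤s z≤n , ∈-upTo⁻ i∈

oneTo-suc : ∀ n → oneTo (suc n) ≡ 1 ∷ map suc (oneTo n)
oneTo-suc n = cong (λ is → 1 ∷ map suc is) (sym (List.map-applyUpTo (λ i → i) suc n))

oneTo-strict : ∀ n → AllPairs _<_ (oneTo n)
oneTo-strict n = AllPairs.map⁺ (AllPairs.applyUpTo⁺₁ (λ i → i) n (λ i<j _ → s≤s i<j))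

∈-words⁻ : ∀ L n {w} → w ∈ words L n → length w ≡ n × All (_∈ L) w
∈-words⁻ L zero (here refl) = refl , []
∈-words⁻ L (suc n) w∈ with find (∈-concatMap⁻ (λ a → map (a ∷_) (words L n)) {xs = L} w∈)
... | a , a∈L , w∈′ with ∈-map⁻ (a ∷_) w∈′
...   | w′ , w′∈ , refl = cong suc (proj₁ (∈-words⁻ L n w′∈)) , a∈L ∷ proj₂ (∈-words⁻ L n w′∈)

∈-words⁺ : ∀ L {w} → All (_∈ L) w → w ∈ words L (length w)
∈-words⁺ L [] = here refl
∈-words⁺ L {a ∷ w} (a∈L ∷ w⊆L) =
  ∈-concatMap⁺ (λ a → map (a ∷_) (words L (length w))) (lose a∈L (∈-map⁺ (a ∷_) (∈-words⁺ L w⊆L)))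

Unique-words : ∀ {L} n → Unique L → Unique (words L n)
Unique-words zero _ = [] ∷ []
Unique-words {L} (suc n) L! = Unique-concatMap (λ a → map (a ∷_) (words L n))
  (AllPairs.map (λ a≢b {v} → different-heads a≢b {v}) L!)
  (All.tabulate (λ _ → Uniqueₚ.map⁺ List.∷-injectiveʳ (Unique-words n L!)))
  where
  different-heads : ∀ {a b} → a ≢ b → Disjoint (map (a ∷_) (words L n)) (map (b ∷_) (words L n))
  different-heads a≢b (v∈a , v∈b) with ∈-map⁻ _ v∈a | ∈-map⁻ _ v∈b
  ... | _ , _ , refl | _ , _ , refl = a≢b refl

words-map : ∀ (ρ : ℕ → ℕ) L n → words (map ρ L) n ≡ map (map ρ) (words L n)
words-map ρ L zero = refl
words-map ρ L (suc n) = begin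
  concatMap (λ a → map (a ∷_) (words (map ρ L) n)) (map ρ L)
    ≡⟨ List.concatMap-map _ ρ L ⟩
  concatMap (λ a → map (ρ a ∷_) (words (map ρ L) n)) L
    ≡⟨ List.concatMap-cong (λ a → cong (map (ρ a ∷_)) (words-map ρ L n)) L ⟩
  concatMap (λ a → map (ρ a ∷_) (map (map ρ) (words L n))) L
    ≡⟨ List.concatMap-cong (λ a → trans (sym (List.map-∘ (words L n))) (List.map-∘ (words L n))) L ⟩
  concatMap (λ a → map (map ρ) (map (a ∷_) (words L n))) L
    ≡⟨ List.map-concatMap (map ρ) (λ a → map (a ∷_) (words L n)) L ⟨
  map (map ρ) (concatMap (λ a → map (a ∷_) (words L n)) L) ∎
  where open ≡-Reasoning

-- abel f C m is, by definition, sumℚ (map (f C) (rearrangements m)).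
rearrangements : List ℕ → List (List ℕ)
rearrangements m =
  filter (λ w → List.≡-dec ℕ._≟_ (sortℕ w) m) (words (deduplicate ℕ._≟_ m) (length m))

∈-rearrangements⁻ : ∀ {m w} → w ∈ rearrangements m → sortℕ w ≡ m
∈-rearrangements⁻ {m} w∈ =
  proj₂ (∈-filter⁻ (λ w → List.≡-dec ℕ._≟_ (sortℕ w) m) {xs = words (deduplicate ℕ._≟_ m) (length m)} w∈)

∈-rearrangements⁺ : ∀ {m w} → sortℕ w ≡ m → w ∈ rearrangements m
∈-rearrangements⁺ {m} {w} sort≡m =
  ∈-filter⁺ (λ w → List.≡-dec ℕ._≟_ (sortℕ w) m)
    (subst (λ n → w ∈ words _ n) (Perm.↭-length w↭m) w∈) sort≡m
  where
  w↭m : w ↭ m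
  w↭m = subst (w ↭_) sort≡m (↭-sym (sortℕ-↭ w))
  w∈ : w ∈ words (deduplicate ℕ._≟_ m) (length w)
  w∈ = ∈-words⁺ _ (All.tabulate (λ x∈w → ∈-deduplicate⁺ ℕ._≟_ (Perm.∈-resp-↭ w↭m x∈w)))

rearrangement-↭ : ∀ {m w} → w ∈ rearrangements m → w ↭ m
rearrangement-↭ {m} {w} w∈ = subst (w ↭_) (∈-rearrangements⁻ w∈) (↭-sym (sortℕ-↭ w))

Unique-rearrangements : ∀ m → Unique (rearrangements m)
Unique-rearrangements m =
  Uniqueₚ.filter⁺ (λ w → List.≡-dec ℕ._≟_ (sortℕ w) m)
    (Unique-words (length m) (Uniqueℕ.deduplicate-! m))

-- Linearity

abel-+ : ∀ f g → abel (f +ₙ g) ≈c (abel f +c abel g)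
abel-+ f g C m _ = sumℚ-map-+ (f C) (g C) (rearrangements m)

abel-· : ∀ c f → abel (c ·ₙ f) ≈c (c ·c abel f)
abel-· c f C m _ = sumℚ-map-*ˡ c (f C) (rearrangements m)

abel-one : abel oneₙ ≈c onec
abel-one [] [] _ = refl
abel-one (_ ∷ _) [] _ = refl
abel-one C (x ∷ m) _ = trans (sumℚ-zero (oneₙ C) (rearrangements (x ∷ m)) vanishes) (sym (onec-∷ C))
  where
  onec-∷ : ∀ C → onec C (x ∷ m) ≡ 0ℚ
  onec-∷ [] = refl
  onec-∷ (_ ∷ _) = refl
  oneₙ-∷ : ∀ C {y w} → oneₙ C (y ∷ w) ≡ 0ℚ
  oneₙ-∷ [] = refl
  oneₙ-∷ (_ ∷ _) = refl
  vanishes : ∀ {w} → w ∈ rearrangements (x ∷ m) → oneₙ C w ≡ 0ℚ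
  vanishes {[]} w∈ with Perm.↭-length (rearrangement-↭ {x ∷ m} w∈)
  ... | ()
  vanishes {_ ∷ _} _ = oneₙ-∷ C

-- Multiplicativity

∈-factorisations⁻ : ∀ w {u v} → (u , v) ∈ factorisations w → u ++ v ≡ w
∈-factorisations⁻ [] (here refl) = refl
∈-factorisations⁻ (x ∷ w) (here refl) = refl
∈-factorisations⁻ (x ∷ w) (there uv∈) with ∈-map⁻ _ uv∈
... | _ , uv∈′ , refl = cong (x ∷_) (∈-factorisations⁻ w uv∈′)

∈-factorisations⁺ : ∀ u v → (u , v) ∈ factorisations (u ++ v)
∈-factorisations⁺ [] [] = here refl
∈-factorisations⁺ [] (x ∷ v) = here refl
∈-factorisations⁺ (x ∷ u) v = there (∈-map⁺ _ (∈-factorisations⁺ u v))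

Unique-factorisations : ∀ w → Unique (factorisations w)
Unique-factorisations [] = [] ∷ []
Unique-factorisations (x ∷ w) =
  All.tabulate (λ uv∈ eq → nonempty-prefix eq uv∈) ∷
  Uniqueₚ.map⁺ cons-injective (Unique-factorisations w)
  where
  cons-injective : ∀ {p q : List ℕ × List ℕ} → (x ∷ proj₁ p , proj₂ p) ≡ (x ∷ proj₁ q , proj₂ q) → p ≡ q
  cons-injective refl = refl
  nonempty-prefix : ∀ {z} → ([] , x ∷ w) ≡ z → z ∉ map (λ p → x ∷ proj₁ p , proj₂ p) (factorisations w)
  nonempty-prefix refl z∈ with ∈-map⁻ _ z∈
  ... | _ , _ , ()

∈-subsets⁻ : ∀ m {a b} → (a , b) ∈ subsets m → a ++ b ↭ m
∈-subsets⁻ [] (here refl) = ↭-refl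
∈-subsets⁻ (x ∷ m) ab∈ with ∈-++⁻ (map (λ p → x ∷ proj₁ p , proj₂ p) (subsets m)) ab∈
... | inj₁ ab∈ˡ with ∈-map⁻ _ ab∈ˡ
...   | (a , b) , ab∈′ , refl = ↭-prep x (∈-subsets⁻ m ab∈′)
∈-subsets⁻ (x ∷ m) ab∈ | inj₂ ab∈ʳ with ∈-map⁻ _ ab∈ʳ
...   | (a , b) , ab∈′ , refl = ↭-trans (Perm.shift x a b) (↭-prep x (∈-subsets⁻ m ab∈′))

subsets-↗ : ∀ m {a b} → Sorted m → (a , b) ∈ subsets m → Sorted a × Sorted b
subsets-↗ [] _ (here refl) = [] , []
subsets-↗ (x ∷ m) m↗ ab∈ with ∈-++⁻ (map (λ p → x ∷ proj₁ p , proj₂ p) (subsets m)) ab∈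
... | inj₁ ab∈ˡ with ∈-map⁻ _ ab∈ˡ
...   | (a , b) , ab∈′ , refl with subsets-↗ m (Linked.tail m↗) ab∈′
...     | a↗ , b↗ =
  Sorted-∷ (λ z∈a → Sorted-head m↗ (there (Perm.∈-resp-↭ (∈-subsets⁻ m ab∈′) (∈-++⁺ˡ z∈a)))) a↗ , b↗
subsets-↗ (x ∷ m) m↗ ab∈ | inj₂ ab∈ʳ with ∈-map⁻ _ ab∈ʳ
...   | (a , b) , ab∈′ , refl with subsets-↗ m (Linked.tail m↗) ab∈′
...     | a↗ , b↗ =
  a↗ , Sorted-∷ (λ z∈b → Sorted-head m↗ (there (Perm.∈-resp-↭ (∈-subsets⁻ m ab∈′) (∈-++⁺ʳ a z∈b)))) b↗

∈-subsets⁺ : ∀ m {a b} → Sorted m → Sorted a → Sorted b → a ++ b ↭ m → (a , b) ∈ subsets m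
∈-subsets⁺ [] {[]} {[]} _ _ _ _ = here refl
∈-subsets⁺ [] {_ ∷ _} _ _ _ p with Perm.↭-length p
... | ()
∈-subsets⁺ [] {[]} {_ ∷ _} _ _ _ p with Perm.↭-length p
... | ()
∈-subsets⁺ (x ∷ m) {a} {b} m↗ a↗ b↗ p with ∈-++⁻ a (Perm.∈-resp-↭ (↭-sym p) (here refl))
∈-subsets⁺ (x ∷ m) {y ∷ a} {b} m↗ a↗ b↗ p | inj₁ x∈a
  with ℕ.≤-antisym (Sorted-head a↗ x∈a) (Sorted-head m↗ (Perm.∈-resp-↭ p (here refl)))
... | refl = ∈-++⁺ˡ (∈-map⁺ _ (∈-subsets⁺ m (Linked.tail m↗) (Linked.tail a↗) b↗ (Perm.drop-∷ p)))
∈-subsets⁺ (x ∷ m) {a} {y ∷ b} m↗ a↗ b↗ p | inj₂ x∈b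
  with ℕ.≤-antisym (Sorted-head b↗ x∈b) (Sorted-head m↗ (Perm.∈-resp-↭ p (∈-++⁺ʳ a (here refl))))
... | refl = ∈-++⁺ʳ _ (∈-map⁺ _ (∈-subsets⁺ m (Linked.tail m↗) a↗ (Linked.tail b↗)
               (Perm.drop-∷ (↭-trans (↭-sym (Perm.shift x a b)) p))))

∈-subMultisets⁻ : ∀ m {q} → q ∈ subMultisets m → q ∈ subsets m
∈-subMultisets⁻ m = ∈-deduplicate⁻ _ (subsets m)

∈-subMultisets⁺ : ∀ m {p} → p ∈ subsets m → ∃[ q ] q ∈ subMultisets m × proj₁ q ≡ proj₁ p
∈-subMultisets⁺ m p∈ = find (Any.deduplicate⁺ _ trans (Any.map (sym ∘ cong proj₁) p∈))

subMultisets-distinct : ∀ m → AllPairs (λ p q → proj₁ p ≢ proj₁ q) (subMultisets m)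
subMultisets-distinct m =
  UniqueDecSetoid.deduplicate-! (On.decSetoid (decSetoid (List.≡-dec ℕ._≟_)) proj₁) (subsets m)

factorisationsOfRearrangements : List ℕ → List (List ℕ × List ℕ)
factorisationsOfRearrangements m = concatMap factorisations (rearrangements m)

rearrangementsOfParts : List ℕ × List ℕ → List (List ℕ × List ℕ)
rearrangementsOfParts q = cartesianProduct (rearrangements (proj₁ q)) (rearrangements (proj₂ q))

rearrangementPairs : List ℕ → List (List ℕ × List ℕ)
rearrangementPairs m = concatMap rearrangementsOfParts (subMultisets m)

∈-factorisationsOfRearrangements : ∀ m {u v} →
  (u , v) ∈ factorisationsOfRearrangements m ⇔ sortℕ (u ++ v) ≡ m
∈-factorisationsOfRearrangements m {u} {v} = mk⇔ to from
  where
  to : (u , v) ∈ factorisationsOfRearrangements m → sortℕ (u ++ v) ≡ m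
  to uv∈ with find (∈-concatMap⁻ factorisations {xs = rearrangements m} uv∈)
  ... | w , w∈ , uv∈w rewrite ∈-factorisations⁻ w uv∈w = ∈-rearrangements⁻ w∈
  from : sortℕ (u ++ v) ≡ m → (u , v) ∈ factorisationsOfRearrangements m
  from sort≡m = ∈-concatMap⁺ factorisations (lose (∈-rearrangements⁺ sort≡m) (∈-factorisations⁺ u v))

∈-rearrangementPairs : ∀ {m} → Sorted m → ∀ {u v} →
  (u , v) ∈ rearrangementPairs m ⇔ sortℕ (u ++ v) ≡ m
∈-rearrangementPairs {m} m↗ {u} {v} = mk⇔ to from
  where
  to : (u , v) ∈ rearrangementPairs m → sortℕ (u ++ v) ≡ m
  to uv∈ with find (∈-concatMap⁻ rearrangementsOfParts {xs = subMultisets m} uv∈)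
  ... | (q₁ , q₂) , q∈ , uv∈q with ∈-cartesianProduct⁻ (rearrangements q₁) _ uv∈q
  ... | u∈ , v∈ = trans (sortℕ-cong-↭ u++v↭m) (sortℕ-↗-id m↗)
    where
    u++v↭m : u ++ v ↭ m
    u++v↭m = ↭-trans (Perm.++⁺ (rearrangement-↭ {q₁} u∈) (rearrangement-↭ {q₂} v∈))
                     (∈-subsets⁻ m (∈-subMultisets⁻ m q∈))
  sorted-parts↭m : sortℕ (u ++ v) ≡ m → sortℕ u ++ sortℕ v ↭ m
  sorted-parts↭m sort≡m =
    ↭-trans (Perm.++⁺ (sortℕ-↭ u) (sortℕ-↭ v)) (subst (u ++ v ↭_) sort≡m (↭-sym (sortℕ-↭ (u ++ v))))
  from : sortℕ (u ++ v) ≡ m → (u , v) ∈ rearrangementPairs m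
  from sort≡m with ∈-subMultisets⁺ m (∈-subsets⁺ m m↗ (sortℕ-↗ u) (sortℕ-↗ v) (sorted-parts↭m sort≡m))
  ... | (q₁ , q₂) , q∈ , refl =
    ∈-concatMap⁺ rearrangementsOfParts
      (lose q∈ (∈-cartesianProduct⁺ (∈-rearrangements⁺ refl) (∈-rearrangements⁺ (sym q₂≡))))
    where
    q∈subsets : (q₁ , q₂) ∈ subsets m
    q∈subsets = ∈-subMultisets⁻ m q∈
    -- subMultisets keeps one pair per first component; as m is sorted, that pair is the right one.
    q₂≡ : q₂ ≡ sortℕ v
    q₂≡ = ↗↭↗⇒≡ (proj₂ (subsets-↗ m m↗ q∈subsets)) (sortℕ-↗ v)
      (↭-++-cancelˡ q₁ (↭-trans (∈-subsets⁻ m q∈subsets) (↭-sym (sorted-parts↭m sort≡m))))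

Unique-factorisationsOfRearrangements : ∀ m → Unique (factorisationsOfRearrangements m)
Unique-factorisationsOfRearrangements m = Unique-concatMap factorisations
  (AllPairs.map (λ w≢w′ {z} → disjoint w≢w′ {z}) (Unique-rearrangements m))
  (All.tabulate (λ {w} _ → Unique-factorisations w))
  where
  disjoint : ∀ {w w′} → w ≢ w′ → Disjoint (factorisations w) (factorisations w′)
  disjoint w≢w′ (z∈ , z∈′) = w≢w′ (trans (sym (∈-factorisations⁻ _ z∈)) (∈-factorisations⁻ _ z∈′))

Unique-rearrangementPairs : ∀ m → Unique (rearrangementPairs m)
Unique-rearrangementPairs m = Unique-concatMap rearrangementsOfParts
  (AllPairs.map (λ {q} {q′} q₁≢q₁′ {z} → disjoint {q} {q′} q₁≢q₁′ {z}) (subMultisets-distinct m))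
  (All.tabulate (λ {q} _ →
    Uniqueₚ.cartesianProduct⁺ (Unique-rearrangements (proj₁ q)) (Unique-rearrangements (proj₂ q))))
  where
  disjoint : ∀ {q q′ : List ℕ × List ℕ} → proj₁ q ≢ proj₁ q′ →
    Disjoint (rearrangementsOfParts q) (rearrangementsOfParts q′)
  disjoint {q} {q′} q₁≢q₁′ (z∈ , z∈′) = q₁≢q₁′ (trans
    (sym (∈-rearrangements⁻ (proj₁ (∈-cartesianProduct⁻ (rearrangements (proj₁ q)) _ z∈))))
    (∈-rearrangements⁻ (proj₁ (∈-cartesianProduct⁻ (rearrangements (proj₁ q′)) _ z∈′))))

factorisationsOfRearrangements-↭ : ∀ {m} → Sorted m →
  factorisationsOfRearrangements m ↭ rearrangementPairs m
factorisationsOfRearrangements-↭ {m} m↗ =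
  ↭-from-members (Unique-factorisationsOfRearrangements m) (Unique-rearrangementPairs m)
    (λ {(u , v)} → mk⇔
      (Equivalence.from (∈-rearrangementPairs m↗) ∘ Equivalence.to (∈-factorisationsOfRearrangements m))
      (Equivalence.from (∈-factorisationsOfRearrangements m) ∘ Equivalence.to (∈-rearrangementPairs m↗)))

sumℚ-factorisationsOfRearrangements : ∀ {m} → Sorted m → ∀ (H : List ℕ × List ℕ → ℚ) →
  sumℚ (map (λ w → sumℚ (map H (factorisations w))) (rearrangements m)) ≡
  sumℚ (map (λ q → sumℚ (map H (rearrangementsOfParts q))) (subMultisets m))
sumℚ-factorisationsOfRearrangements {m} m↗ H = begin
  sumℚ (map (λ w → sumℚ (map H (factorisations w))) (rearrangements m))
    ≡⟨ sumℚ-map-concatMap H factorisations (rearrangements m) ⟨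
  sumℚ (map H (factorisationsOfRearrangements m))
    ≡⟨ sumℚ-↭ (Perm.map⁺ H (factorisationsOfRearrangements-↭ m↗)) ⟩
  sumℚ (map H (rearrangementPairs m))
    ≡⟨ sumℚ-map-concatMap H rearrangementsOfParts (subMultisets m) ⟩
  sumℚ (map (λ q → sumℚ (map H (rearrangementsOfParts q))) (subMultisets m)) ∎
  where open ≡-Reasoning

abel-* : ∀ f g → abel (f *ₙ g) ≈c (abel f *c abel g)
abel-* f g C m (_ , m-nondecr) = begin
  abel (f *ₙ g) C m
    ≡⟨ sumℚ-cong _ _ (rearrangements m) (λ {w} _ →
         sumℚ-concatMap (λ AB → map (term AB) (factorisations w)) (subsets C)) ⟩
  sumℚ (map (λ w → sumℚ (map (λ AB → overFactorisations AB w) (subsets C))) (rearrangements m))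
    ≡⟨ sumℚ-comm (λ w AB → overFactorisations AB w) (rearrangements m) (subsets C) ⟩
  sumℚ (map (λ AB → sumℚ (map (overFactorisations AB) (rearrangements m))) (subsets C))
    ≡⟨ sumℚ-cong _ _ (subsets C) (λ {AB} _ → sumℚ-factorisationsOfRearrangements m↗ (term AB)) ⟩
  sumℚ (map (λ AB → sumℚ (map (overParts AB) (subMultisets m))) (subsets C))
    ≡⟨ sumℚ-cong _ _ (subsets C) (λ {AB} _ → sumℚ-cong _ _ (subMultisets m) (λ {q} _ →
         sumℚ-cartesianProduct (sgn (proj₁ AB) (proj₂ AB)) (f (proj₁ AB)) (g (proj₂ AB))
                               (rearrangements (proj₁ q)) (rearrangements (proj₂ q)))) ⟩
  sumℚ (map (λ AB → sumℚ (map (term′ AB) (subMultisets m))) (subsets C))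
    ≡⟨ sumℚ-concatMap (λ AB → map (term′ AB) (subMultisets m)) (subsets C) ⟨
  (abel f *c abel g) C m ∎
  where
  open ≡-Reasoning
  m↗ = NonDecr⇒Sorted m m-nondecr
  term : List ℕ × List ℕ → List ℕ × List ℕ → ℚ
  term AB uv = sgn (proj₁ AB) (proj₂ AB) * (f (proj₁ AB) (proj₁ uv) * g (proj₂ AB) (proj₂ uv))
  term′ : List ℕ × List ℕ → List ℕ × List ℕ → ℚ
  term′ AB q = sgn (proj₁ AB) (proj₂ AB) * (abel f (proj₁ AB) (proj₁ q) * abel g (proj₂ AB) (proj₂ q))
  overFactorisations : List ℕ × List ℕ → List ℕ → ℚ
  overFactorisations AB w = sumℚ (map (term AB) (factorisations w))
  overParts : List ℕ × List ℕ → List ℕ × List ℕ → ℚ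
  overParts AB q = sumℚ (map (term AB) (rearrangementsOfParts q))

flag : Bool → ℕ → List ℕ
flag b k = if b then k ∷ [] else []

private
  positionsFrom : List ℕ → ℕ → List ℕ → List ℕ
  positionsFrom is r u = map proj₁ (filter (λ p → proj₂ p ℕ.≟ r) (zip is u))

  positionsFrom-shift : ∀ r is u → positionsFrom (map suc is) r u ≡ map suc (positionsFrom is r u)
  positionsFrom-shift r [] u = refl
  positionsFrom-shift r (i ∷ is) [] = refl
  positionsFrom-shift r (i ∷ is) (x ∷ u) with x ≡ᵇ r
  ... | true = cong (suc i ∷_) (positionsFrom-shift r is u)
  ... | false = positionsFrom-shift r is u

  positions-tail : ∀ r u →
    positionsFrom (map suc (Data.List.applyUpTo suc (length u))) r u ≡ map suc (positions r u)
  positions-tail r u =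
    trans (cong (λ is → positionsFrom (map suc is) r u)
                (sym (List.map-applyUpTo (λ i → i) suc (length u))))
          (positionsFrom-shift r (oneTo (length u)) u)

positions-∷ : ∀ r x u → positions r (x ∷ u) ≡ flag (x ≡ᵇ r) 1 ++ map suc (positions r u)
positions-∷ r x u with x ≡ᵇ r
... | true = cong (1 ∷_) (positions-tail r u)
... | false = positions-tail r u

positions-∷-≡ : ∀ x u → positions x (x ∷ u) ≡ 1 ∷ map suc (positions x u)
positions-∷-≡ x u = trans (positions-∷ x x u)
  (cong (λ b → flag b 1 ++ map suc (positions x u)) (dec-true (x ℕ.≟ x) refl))

positions-∷-≢ : ∀ {x r} u → x ≢ r → positions r (x ∷ u) ≡ map suc (positions r u)
positions-∷-≢ {x} {r} u x≢r = trans (positions-∷ r x u)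
  (cong (λ b → flag b 1 ++ map suc (positions r u)) (dec-false (x ℕ.≟ r) x≢r))

positions-nonzero : ∀ r u → All (_≢ 0) (positions r u)
positions-nonzero r [] = []
positions-nonzero r (x ∷ u) = subst (All (_≢ 0)) (sym (positions-∷ r x u))
  (All.++⁺ (marker (x ≡ᵇ r)) (All.map⁺ (All.tabulate (λ _ ()))))
  where
  marker : ∀ b → All (_≢ 0) (flag b 1)
  marker true = (λ ()) ∷ []
  marker false = []

length-positions : ∀ r u → length (positions r u) ≡ count r u
length-positions r [] = refl
length-positions r (x ∷ u) with r ℕ.≟ x
... | yes refl = begin
  length (positions r (r ∷ u))       ≡⟨ cong length (positions-∷-≡ r u) ⟩
  suc (length (map suc (positions r u))) ≡⟨ cong suc (List.length-map suc (positions r u)) ⟩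
  suc (length (positions r u))       ≡⟨ cong suc (length-positions r u) ⟩
  suc (count r u)                    ≡⟨ count-∷-≡ r u ⟨
  count r (r ∷ u)                    ∎
  where open ≡-Reasoning
... | no r≢x = begin
  length (positions r (x ∷ u))       ≡⟨ cong length (positions-∷-≢ u (r≢x ∘ sym)) ⟩
  length (map suc (positions r u))   ≡⟨ List.length-map suc (positions r u) ⟩
  length (positions r u)             ≡⟨ length-positions r u ⟩
  count r u                          ≡⟨ count-∷-≢ u r≢x ⟨
  count r (x ∷ u)                    ∎
  where open ≡-Reasoning

positions-injective : ∀ {L} u v → u ⊆ L → v ⊆ L → (∀ {r} → r ∈ L → positions r u ≡ positions r v) → u ≡ v
positions-injective [] [] _ _ _ = refl
positions-injective [] (y ∷ v) _ v⊆ same with trans (same (v⊆ (here refl))) (positions-∷-≡ y v)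
... | ()
positions-injective (x ∷ u) [] u⊆ _ same with trans (sym (same (u⊆ (here refl)))) (positions-∷-≡ x u)
... | ()
positions-injective {L} (x ∷ u) (y ∷ v) u⊆ v⊆ same with y ℕ.≟ x
... | yes refl = cong (x ∷_) (positions-injective u v (u⊆ ∘ there) (v⊆ ∘ there) tails)
  where
  tails : ∀ {r} → r ∈ L → positions r u ≡ positions r v
  tails {r} r∈ = List.map-injective ℕ.suc-injective (List.++-cancelˡ (flag (x ≡ᵇ r) 1)
    (map suc (positions r u)) (map suc (positions r v))
    (trans (sym (positions-∷ r x u)) (trans (same r∈) (positions-∷ r x v))))
... | no y≢x = ⊥-elim (starts-at-one (positions x v) (positions-nonzero x v)
  (trans (sym (positions-∷-≡ x u)) (trans (same (u⊆ (here refl))) (positions-∷-≢ v y≢x))))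
  where
  starts-at-one : ∀ {xs} ps → All (_≢ 0) ps → 1 ∷ xs ≢ map suc ps
  starts-at-one (p ∷ _) (p≢0 ∷ _) eq = p≢0 (sym (ℕ.suc-injective (List.∷-injectiveˡ eq)))

positions-map-oneTo : ∀ (g : ℕ → ℕ) r n →
  positions r (map g (oneTo n)) ≡ filter (λ t → g t ℕ.≟ r) (oneTo n)
positions-map-oneTo g r zero = refl
positions-map-oneTo g r (suc n) = begin
  positions r (map g (oneTo (suc n)))
    ≡⟨ cong (positions r ∘ map g) (oneTo-suc n) ⟩
  positions r (g 1 ∷ map g (map suc (oneTo n)))
    ≡⟨ positions-∷ r (g 1) _ ⟩
  marker ++ map suc (positions r (map g (map suc (oneTo n))))
    ≡⟨ cong (λ P → marker ++ map suc P)
            (trans (cong (positions r) (sym (List.map-∘ (oneTo n))))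
                   (positions-map-oneTo (g ∘ suc) r n)) ⟩
  marker ++ map suc (filter (λ t → g (suc t) ℕ.≟ r) (oneTo n))
    ≡⟨ cong (marker ++_)
            (filter-map (λ t → g t ℕ.≟ r) (λ t → g (suc t) ℕ.≟ r) suc (oneTo n) (λ _ → refl)) ⟨
  marker ++ filter (λ t → g t ℕ.≟ r) (map suc (oneTo n))
    ≡⟨ marked-filter ⟩
  filter (λ t → g t ℕ.≟ r) (1 ∷ map suc (oneTo n))
    ≡⟨ cong (filter (λ t → g t ℕ.≟ r)) (oneTo-suc n) ⟨
  filter (λ t → g t ℕ.≟ r) (oneTo (suc n)) ∎
  where
  open ≡-Reasoning
  marker = flag (g 1 ≡ᵇ r) 1
  F = filter (λ t → g t ℕ.≟ r) (map suc (oneTo n))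
  marked-filter : marker ++ F ≡ filter (λ t → g t ℕ.≟ r) (1 ∷ map suc (oneTo n))
  marked-filter with g 1 ≡ᵇ r
  ... | true = refl
  ... | false = refl

-- Order-preserving relabellings

module OrderEmbedding (L : List ℕ) (ρ : ℕ → ℕ)
  (ρ-mono : ∀ {x y} → x ∈ L → y ∈ L → x < y → ρ x < ρ y) where

  ρ-injective : ∀ {x y} → x ∈ L → y ∈ L → ρ x ≡ ρ y → x ≡ y
  ρ-injective {x} {y} x∈ y∈ ρx≡ρy with ℕ.<-cmp x y
  ... | tri< x<y _ _ = ⊥-elim (ℕ.<⇒≢ (ρ-mono x∈ y∈ x<y) ρx≡ρy)
  ... | tri≈ _ x≡y _ = x≡y
  ... | tri> _ _ y<x = ⊥-elim (ℕ.<⇒≢ (ρ-mono y∈ x∈ y<x) (sym ρx≡ρy))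

  ρ-<⇔ : ∀ {x y} → x ∈ L → y ∈ L → ρ x < ρ y ⇔ x < y
  ρ-<⇔ {x} {y} x∈ y∈ = mk⇔ reflect (ρ-mono x∈ y∈)
    where
    reflect : ρ x < ρ y → x < y
    reflect ρx<ρy with ℕ.<-cmp x y
    ... | tri< x<y _ _ = x<y
    ... | tri≈ _ refl _ = ⊥-elim (ℕ.<-irrefl refl ρx<ρy)
    ... | tri> _ _ y<x = ⊥-elim (ℕ.<-asym ρx<ρy (ρ-mono y∈ x∈ y<x))

  ρ-≤⇔ : ∀ {x y} → x ∈ L → y ∈ L → ρ x ≤ ρ y ⇔ x ≤ y
  ρ-≤⇔ x∈ y∈ = mk⇔
    (λ ρx≤ρy → ℕ.≮⇒≥ (λ y<x → ℕ.<⇒≱ (ρ-mono y∈ x∈ y<x) ρx≤ρy))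
    (λ x≤y → ℕ.≮⇒≥ (λ ρy<ρx → ℕ.<⇒≱ (Equivalence.to (ρ-<⇔ y∈ x∈) ρy<ρx) x≤y))

  ρ-≡⇔ : ∀ {x y} → x ∈ L → y ∈ L → ρ x ≡ ρ y ⇔ x ≡ y
  ρ-≡⇔ x∈ y∈ = mk⇔ (ρ-injective x∈ y∈) (cong ρ)

  ρ-≤ᵇ : ∀ {x y} → x ∈ L → y ∈ L → (ρ x ≤ᵇ ρ y) ≡ (x ≤ᵇ y)
  ρ-≤ᵇ {x} {y} x∈ y∈ = does-⇔ (ρ-≤⇔ x∈ y∈) (ρ x ℕ.≤? ρ y) (x ℕ.≤? y)

  ρ-≡ᵇ : ∀ {x y} → x ∈ L → y ∈ L → (ρ x ≡ᵇ ρ y) ≡ (x ≡ᵇ y)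
  ρ-≡ᵇ {x} {y} x∈ y∈ = does-⇔ (ρ-≡⇔ x∈ y∈) (ρ x ℕ.≟ ρ y) (x ℕ.≟ y)

  map-ρ-injective : ∀ {xs ys} → xs ⊆ L → ys ⊆ L → map ρ xs ≡ map ρ ys → xs ≡ ys
  map-ρ-injective {[]} {[]} _ _ _ = refl
  map-ρ-injective {x ∷ xs} {y ∷ ys} xs⊆ ys⊆ eq = cong₂ _∷_
    (ρ-injective (xs⊆ (here refl)) (ys⊆ (here refl)) (List.∷-injectiveˡ eq))
    (map-ρ-injective (xs⊆ ∘ there) (ys⊆ ∘ there) (List.∷-injectiveʳ eq))

  insert-map : ∀ {x} ys → x ∈ L → ys ⊆ L → insert (ρ x) (map ρ ys) ≡ map ρ (insert x ys)
  insert-map [] _ _ = refl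
  insert-map {x} (y ∷ ys) x∈ ys⊆ rewrite ρ-≤ᵇ x∈ (ys⊆ (here refl)) with x ≤ᵇ y
  ... | true = refl
  ... | false = cong (ρ y ∷_) (insert-map ys x∈ (ys⊆ ∘ there))

  sortℕ-map : ∀ ys → ys ⊆ L → sortℕ (map ρ ys) ≡ map ρ (sortℕ ys)
  sortℕ-map [] _ = refl
  sortℕ-map (y ∷ ys) ys⊆ = trans (cong (insert (ρ y)) (sortℕ-map ys (ys⊆ ∘ there)))
    (insert-map (sortℕ ys) (ys⊆ (here refl)) (ys⊆ ∘ there ∘ Perm.∈-resp-↭ (sortℕ-↭ ys)))

  deduplicate-map : ∀ ys → ys ⊆ L → deduplicate ℕ._≟_ (map ρ ys) ≡ map ρ (deduplicate ℕ._≟_ ys)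
  deduplicate-map [] _ = refl
  deduplicate-map (y ∷ ys) ys⊆ = cong (ρ y ∷_) (trans
    (cong (filter (¬? ∘ (ρ y ℕ.≟_))) (deduplicate-map ys (ys⊆ ∘ there)))
    (filter-map (¬? ∘ (ρ y ℕ.≟_)) (¬? ∘ (y ℕ.≟_)) ρ _
      (λ z∈ → cong not (ρ-≡ᵇ (ys⊆ (here refl)) (ys⊆ (there (∈-deduplicate⁻ ℕ._≟_ ys z∈)))))))

  indexSet-map : ∀ C w → C ⊆ L → w ⊆ L → indexSet (map ρ C) (map ρ w) ≡ map ρ (indexSet C w)
  indexSet-map C w C⊆ w⊆ = begin
    sortℕ (deduplicate ℕ._≟_ (map ρ C ++ map ρ w))
      ≡⟨ cong (sortℕ ∘ deduplicate ℕ._≟_) (List.map-++ ρ C w) ⟨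
    sortℕ (deduplicate ℕ._≟_ (map ρ (C ++ w)))
      ≡⟨ cong sortℕ (deduplicate-map (C ++ w) C++w⊆) ⟩
    sortℕ (map ρ (deduplicate ℕ._≟_ (C ++ w)))
      ≡⟨ sortℕ-map _ (C++w⊆ ∘ ∈-deduplicate⁻ ℕ._≟_ (C ++ w)) ⟩
    map ρ (indexSet C w) ∎
    where
    open ≡-Reasoning
    C++w⊆ : C ++ w ⊆ L
    C++w⊆ = [ C⊆ , w⊆ ]′ ∘ ∈-++⁻ C

  rank-map : ∀ {S x} → S ⊆ L → x ∈ L → rank (map ρ S) (ρ x) ≡ rank S x
  rank-map {S} {x} S⊆ x∈ = cong suc (trans
    (cong length (filter-map (ℕ._<? ρ x) (ℕ._<? x) ρ S
      (λ {s} s∈ → does-⇔ (ρ-<⇔ (S⊆ s∈) x∈) (ρ s ℕ.<? ρ x) (s ℕ.<? x))))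
    (List.length-map ρ (filter (ℕ._<? x) S)))

  std-map : ∀ C w → C ⊆ L → w ⊆ L → std (map ρ C) (map ρ w) ≡ std C w
  std-map C w C⊆ w⊆ rewrite indexSet-map C w C⊆ w⊆ = cong₂ _,_ (ranks C C⊆) (ranks w w⊆)
    where
    S⊆ : indexSet C w ⊆ L
    S⊆ = [ C⊆ , w⊆ ]′ ∘ ∈-++⁻ C ∘ Equivalence.to (∈-sortedSet (C ++ w))
    ranks : ∀ xs → xs ⊆ L → map (rank (map ρ (indexSet C w))) (map ρ xs) ≡ map (rank (indexSet C w)) xs
    ranks xs xs⊆ =
      trans (sym (List.map-∘ xs)) (List.map-cong-local (All.tabulate (λ x∈ → rank-map S⊆ (xs⊆ x∈))))

  elem-map : ∀ {x} ys → x ∈ L → ys ⊆ L → elem (ρ x) (map ρ ys) ≡ elem x ys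
  elem-map [] _ _ = refl
  elem-map {x} (y ∷ ys) x∈ ys⊆ rewrite ρ-≡ᵇ x∈ (ys⊆ (here refl)) with x ≡ᵇ y
  ... | true = refl
  ... | false = elem-map ys x∈ (ys⊆ ∘ there)

  positions-map : ∀ {r} u → r ∈ L → u ⊆ L → positions (ρ r) (map ρ u) ≡ positions r u
  positions-map [] _ _ = refl
  positions-map {r} (x ∷ u) r∈ u⊆ = begin
    positions (ρ r) (ρ x ∷ map ρ u)
      ≡⟨ positions-∷ (ρ r) (ρ x) (map ρ u) ⟩
    flag (ρ x ≡ᵇ ρ r) 1 ++ map suc (positions (ρ r) (map ρ u))
      ≡⟨ cong₂ (λ b P → flag b 1 ++ map suc P)
               (ρ-≡ᵇ (u⊆ (here refl)) r∈) (positions-map u r∈ (u⊆ ∘ there)) ⟩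
    flag (x ≡ᵇ r) 1 ++ map suc (positions r u)
      ≡⟨ positions-∷ r x u ⟨
    positions r (x ∷ u) ∎
    where open ≡-Reasoning

  rearrangements-map : ∀ m → m ⊆ L → rearrangements (map ρ m) ≡ map (map ρ) (rearrangements m)
  rearrangements-map m m⊆ = begin
    filter P′ (words (deduplicate ℕ._≟_ (map ρ m)) (length (map ρ m)))
      ≡⟨ cong₂ (λ L′ n → filter P′ (words L′ n)) (deduplicate-map m m⊆) (List.length-map ρ m) ⟩
    filter P′ (words (map ρ (deduplicate ℕ._≟_ m)) (length m))
      ≡⟨ cong (filter P′) (words-map ρ _ (length m)) ⟩
    filter P′ (map (map ρ) (words (deduplicate ℕ._≟_ m) (length m)))
      ≡⟨ filter-map P′ P (map ρ) _ agree ⟩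
    map (map ρ) (rearrangements m) ∎
    where
    open ≡-Reasoning
    P′ = λ w → List.≡-dec ℕ._≟_ (sortℕ w) (map ρ m)
    P = λ w → List.≡-dec ℕ._≟_ (sortℕ w) m
    agree : ∀ {w} → w ∈ words (deduplicate ℕ._≟_ m) (length m) → does (P′ (map ρ w)) ≡ does (P w)
    agree {w} w∈ = does-⇔ (mk⇔
      (λ eq → map-ρ-injective (w⊆ ∘ Perm.∈-resp-↭ (sortℕ-↭ w)) m⊆ (trans (sym (sortℕ-map w w⊆)) eq))
      (λ eq → trans (sortℕ-map w w⊆) (cong (map ρ) eq))) (P′ (map ρ w)) (P w)
      where
      w⊆ : w ⊆ L
      w⊆ x∈ = m⊆ (∈-deduplicate⁻ ℕ._≟_ m (All.lookup (proj₂ (∈-words⁻ _ (length m) w∈)) x∈))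

  abel-map : ∀ {f} → sNCQSym f → ∀ C m → C ⊆ L → m ⊆ L → Incr C → Incr (map ρ C) →
    abel f (map ρ C) (map ρ m) ≡ abel f C m
  abel-map {f} (_ , f-std) C m C⊆ m⊆ C↗ ρC↗ = begin
    sumℚ (map (f (map ρ C)) (rearrangements (map ρ m)))
      ≡⟨ cong (sumℚ ∘ map (f (map ρ C))) (rearrangements-map m m⊆) ⟩
    sumℚ (map (f (map ρ C)) (map (map ρ) (rearrangements m)))
      ≡⟨ cong sumℚ (List.map-∘ (rearrangements m)) ⟨
    sumℚ (map (f (map ρ C) ∘ map ρ) (rearrangements m))
      ≡⟨ sumℚ-cong _ (f C) (rearrangements m) relabel-invariant ⟩
    sumℚ (map (f C) (rearrangements m)) ∎
    where
    open ≡-Reasoning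
    relabel-invariant : ∀ {w} → w ∈ rearrangements m → f (map ρ C) (map ρ w) ≡ f C w
    relabel-invariant {w} w∈ = f-std (map ρ C) (map ρ w) C w ρC↗ C↗
      (std-map C w C⊆ (m⊆ ∘ Perm.∈-resp-↭ (rearrangement-↭ {m} w∈)))

-- Quasisymmetry

relabel : List ℕ → List ℕ → ℕ → ℕ
relabel (i ∷ is) (j ∷ js) x = if x ≡ᵇ i then j else relabel is js x
relabel _ _ x = x

relabel-here : ∀ i is j js → relabel (i ∷ is) (j ∷ js) i ≡ j
relabel-here i is j js rewrite dec-true (i ℕ.≟ i) refl = refl

relabel-there : ∀ {i x} is j js → x ≢ i → relabel (i ∷ is) (j ∷ js) x ≡ relabel is js x
relabel-there {i} {x} is j js x≢i rewrite dec-false (x ℕ.≟ i) x≢i = refl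

relabel-map : ∀ {is js} → AllPairs _<_ is → length is ≡ length js → map (relabel is js) is ≡ js
relabel-map {[]} {[]} _ _ = refl
relabel-map {i ∷ is} {j ∷ js} (i< ∷ is<) len = cong₂ _∷_ (relabel-here i is j js) (trans
  (List.map-cong-local (All.map (λ i<x → relabel-there is j js (ℕ.>⇒≢ i<x)) i<))
  (relabel-map is< (ℕ.suc-injective len)))

relabel-mono : ∀ {is js} → AllPairs _<_ is → AllPairs _<_ js → length is ≡ length js →
  ∀ {x y} → x ∈ is → y ∈ is → x < y → relabel is js x < relabel is js y
relabel-mono {i ∷ is} {j ∷ js} _ _ _ (here refl) (here refl) x<x = ⊥-elim (ℕ.<-irrefl refl x<x)
relabel-mono {i ∷ is} {j ∷ js} (i< ∷ is<) (j< ∷ _) len {y = y} (here refl) (there y∈) _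
  rewrite relabel-here i is j js | relabel-there is j js (ℕ.>⇒≢ (All.lookup i< y∈)) =
  All.lookup j< (subst (relabel is js y ∈_) (relabel-map is< (ℕ.suc-injective len))
                       (∈-map⁺ (relabel is js) y∈))
relabel-mono {i ∷ is} (i< ∷ _) _ _ (there x∈) (here refl) x<i = ⊥-elim (ℕ.<-asym x<i (All.lookup i< x∈))
relabel-mono {i ∷ is} {j ∷ js} (i< ∷ is<) (_ ∷ js<) len (there x∈) (there y∈) x<y
  rewrite relabel-there is j js (ℕ.>⇒≢ (All.lookup i< x∈))
        | relabel-there is j js (ℕ.>⇒≢ (All.lookup i< y∈)) =
  relabel-mono is< js< (ℕ.suc-injective len) x∈ y∈ x<y

monoOf-map : ∀ (ρ : ℕ → ℕ) is a →
  monoOf (map ρ is) a ≡ (map ρ (proj₁ (monoOf is a)) , map ρ (proj₂ (monoOf is a)))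
monoOf-map ρ [] a = refl
monoOf-map ρ (i ∷ is) [] = refl
monoOf-map ρ (i ∷ is) ((n , e) ∷ a) rewrite monoOf-map ρ is a = cong₂ _,_
  (sym (Bool.if-float (map ρ) e))
  (sym (trans (List.map-++ ρ (replicate n i) _) (cong (_++ _) (List.map-replicate ρ n i))))

monoOf-⊆₁ : ∀ is a → proj₁ (monoOf is a) ⊆ is
monoOf-⊆₁ (i ∷ is) ((n , true) ∷ a) (here refl) = here refl
monoOf-⊆₁ (i ∷ is) ((n , true) ∷ a) (there x∈) = there (monoOf-⊆₁ is a x∈)
monoOf-⊆₁ (i ∷ is) ((n , false) ∷ a) x∈ = there (monoOf-⊆₁ is a x∈)

monoOf-⊆₂ : ∀ is a → proj₂ (monoOf is a) ⊆ is
monoOf-⊆₂ (i ∷ is) ((n , e) ∷ a) x∈ with ∈-++⁻ (replicate n i) x∈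
... | inj₁ x∈rep = here (All.lookup (All.replicate⁺ {P = _≡ i} n refl) x∈rep)
... | inj₂ x∈′ = there (monoOf-⊆₂ is a x∈′)

monoOf-strict : ∀ is a → AllPairs _<_ is → AllPairs _<_ (proj₁ (monoOf is a))
monoOf-strict [] a _ = []
monoOf-strict (i ∷ is) [] _ = []
monoOf-strict (i ∷ is) ((n , true) ∷ a) (i< ∷ is<) =
  All.tabulate (All.lookup i< ∘ monoOf-⊆₁ is a) ∷ monoOf-strict is a is<
monoOf-strict (i ∷ is) ((n , false) ∷ a) (_ ∷ is<) = monoOf-strict is a is<

abel-boundedDegree : ∀ {f} → BoundedDegreeₙ f → BoundedDegreec (abel f)
abel-boundedDegree {f} (d , bounded) = d , bound
  where
  bound : ∀ C m → ValidC C m → abel f C m ≢ 0ℚ → length C Data.Nat.+ length m ≤ d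
  bound C m (C↗ , _) abel≢0 with sumℚ-nonzero (f C) (rearrangements m) abel≢0
  ... | w , w∈ , fw≢0 =
    subst (λ k → length C Data.Nat.+ k ≤ d) (Perm.↭-length (rearrangement-↭ {m} w∈))
      (bounded C w C↗ fw≢0)

abel-quasisymmetric : ∀ {f} → sNCQSym f → ∀ a is js → Incr is → Incr js →
  length is ≡ length a → length js ≡ length a →
  coeffAt (abel f) (monoOf is a) ≡ coeffAt (abel f) (monoOf js a)
abel-quasisymmetric {f} f-sym a is js is↗ js↗ |is|≡ |js|≡ = begin
  abel f C m                      ≡⟨ abel-map f-sym C m (monoOf-⊆₁ is a) (monoOf-⊆₂ is a) C↗ ρC↗ ⟨
  abel f (map ρ C) (map ρ m)      ≡⟨ cong (coeffAt (abel f)) monoOf-js ⟨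
  coeffAt (abel f) (monoOf js a)  ∎
  where
  open ≡-Reasoning
  is< = Incr⇒AllPairs is↗
  js< = Incr⇒AllPairs js↗
  |is|≡|js| = trans |is|≡ (sym |js|≡)
  ρ = relabel is js
  open OrderEmbedding is ρ (relabel-mono is< js< |is|≡|js|)
  C = proj₁ (monoOf is a)
  m = proj₂ (monoOf is a)
  monoOf-js : monoOf js a ≡ (map ρ C , map ρ m)
  monoOf-js = trans (cong (λ ks → monoOf ks a) (sym (relabel-map is< |is|≡|js|))) (monoOf-map ρ is a)
  C↗ : Incr C
  C↗ = AllPairs⇒Incr (monoOf-strict is a is<)
  ρC↗ : Incr (map ρ C)
  ρC↗ = subst Incr (cong proj₁ monoOf-js) (AllPairs⇒Incr (monoOf-strict js a js<))

abel-sQSym : ∀ f → sNCQSym f → sQSym (abel f)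
abel-sQSym f f-sym = abel-boundedDegree (proj₁ f-sym) , λ a _ → abel-quasisymmetric f-sym a

-- The blocks of I(θ_C x_w)

rank-head : ∀ {x S} → All (x <_) S → rank (x ∷ S) x ≡ 1
rank-head {x} {S} x<S = cong (λ F → suc (length F)) (trans
  (List.filter-reject (ℕ._<? x) (ℕ.<-irrefl refl))
  (List.filter-none (ℕ._<? x) (All.map ℕ.<⇒≯ x<S)))

rank-tail : ∀ {x S y} → All (x <_) S → y ∈ S → rank (x ∷ S) y ≡ suc (rank S y)
rank-tail {x} {S} {y} x<S y∈ =
  cong (λ F → suc (length F)) (List.filter-accept (ℕ._<? y) (All.lookup x<S y∈))

rank-mono : ∀ {S} → AllPairs _<_ S → ∀ {x y} → x ∈ S → y ∈ S → x < y → rank S x < rank S y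
rank-mono (_ ∷ _) (here refl) (here refl) x<x = ⊥-elim (ℕ.<-irrefl refl x<x)
rank-mono (z< ∷ _) (here refl) (there y∈) _ rewrite rank-head z< | rank-tail z< y∈ = s≤s (s≤s z≤n)
rank-mono (z< ∷ _) (there x∈) (here refl) x<z = ⊥-elim (ℕ.<-asym x<z (All.lookup z< x∈))
rank-mono (z< ∷ S<) (there x∈) (there y∈) x<y rewrite rank-tail z< x∈ | rank-tail z< y∈ =
  s≤s (rank-mono S< x∈ y∈ x<y)

map-rank-self : ∀ {S} → AllPairs _<_ S → map (rank S) S ≡ oneTo (length S)
map-rank-self [] = refl
map-rank-self {z ∷ S} (z< ∷ S<) = begin
  rank (z ∷ S) z ∷ map (rank (z ∷ S)) S
    ≡⟨ cong₂ _∷_ (rank-head z<) (List.map-cong-local (All.tabulate (rank-tail z<))) ⟩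
  1 ∷ map (suc ∘ rank S) S               ≡⟨ cong (1 ∷_) (List.map-∘ S) ⟩
  1 ∷ map suc (map (rank S) S)           ≡⟨ cong (λ is → 1 ∷ map suc is) (map-rank-self S<) ⟩
  1 ∷ map suc (oneTo (length S))         ≡⟨ oneTo-suc (length S) ⟨
  oneTo (length (z ∷ S))                 ∎
  where open ≡-Reasoning

indexSet-strict : ∀ C w → AllPairs _<_ (indexSet C w)
indexSet-strict C w = sortedSet-strict (C ++ w)

indexSet-⊇ˡ : ∀ C w → C ⊆ indexSet C w
indexSet-⊇ˡ C w = Equivalence.from (∈-sortedSet (C ++ w)) ∘ ∈-++⁺ˡ

indexSet-⊇ʳ : ∀ C w → w ⊆ indexSet C w
indexSet-⊇ʳ C w = Equivalence.from (∈-sortedSet (C ++ w)) ∘ ∈-++⁺ʳ C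

indexSet-↭ : ∀ C {w v} → w ↭ v → indexSet C w ≡ indexSet C v
indexSet-↭ C {w} {v} w↭v =
  strict-≡ (indexSet-strict C w) (indexSet-strict C v) (mk⇔ (transport w↭v) (transport (↭-sym w↭v)))
  where
  transport : ∀ {u u′} → u ↭ u′ → indexSet C u ⊆ indexSet C u′
  transport {u} {u′} u↭u′ = Equivalence.from (∈-sortedSet (C ++ u′)) ∘ Perm.∈-resp-↭ (Perm.++⁺ˡ C u↭u′)
                          ∘ Equivalence.to (∈-sortedSet (C ++ u))

block : List ℕ → List ℕ → ℕ → List ℕ
block C w s = flag (elem s C) 0 ++ positions s w

Isc-blocks : ∀ C w → Isc C w ≡ map (block C w) (indexSet C w)
Isc-blocks C w = begin
  map rankedBlock (oneTo (length S))       ≡⟨ cong (map rankedBlock) (map-rank-self S<) ⟨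
  map rankedBlock (map (rank S) S)         ≡⟨ List.map-∘ S ⟨
  map (rankedBlock ∘ rank S) S             ≡⟨ List.map-cong-local (All.tabulate unrank) ⟩
  map (block C w) S                        ∎
  where
  open ≡-Reasoning
  S = indexSet C w
  S< = indexSet-strict C w
  open OrderEmbedding S (rank S) (rank-mono S<)
  rankedBlock : ℕ → List ℕ
  rankedBlock r = flag (elem r (map (rank S) C)) 0 ++ positions r (map (rank S) w)
  unrank : ∀ {s} → s ∈ S → rankedBlock (rank S s) ≡ block C w s
  unrank s∈ = cong₂ (λ b P → flag b 0 ++ P)
    (elem-map C s∈ (indexSet-⊇ˡ C w)) (positions-map w s∈ (indexSet-⊇ʳ C w))

nonzero : List ℕ → List ℕ
nonzero = filter (λ x → ¬? (x ℕ.≟ 0))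

dottedEntry : List ℕ → ℕ × Bool
dottedEntry B = length (nonzero B) , elem 0 B

nonzero-flag : ∀ b P → All (_≢ 0) P → nonzero (flag b 0 ++ P) ≡ P
nonzero-flag true P P≢0 = List.filter-all _ P≢0
nonzero-flag false P P≢0 = List.filter-all _ P≢0

elem0-flag : ∀ b P → All (_≢ 0) P → elem 0 (flag b 0 ++ P) ≡ b
elem0-flag true P _ = refl
elem0-flag false P P≢0 = elem-∉ P (λ 0∈ → All.lookup P≢0 0∈ refl)

α-Isc : ∀ C w → α (Isc C w) ≡ typeC C w
α-Isc C w = begin
  map dottedEntry (Isc C w)                       ≡⟨ cong (map dottedEntry) (Isc-blocks C w) ⟩
  map dottedEntry (map (block C w) S)             ≡⟨ List.map-∘ S ⟨
  map (dottedEntry ∘ block C w) S                 ≡⟨ List.map-cong dottedEntry-block S ⟩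
  map (λ s → count s w , elem s C) S              ∎
  where
  open ≡-Reasoning
  S = indexSet C w
  dottedEntry-block : ∀ s → dottedEntry (block C w s) ≡ (count s w , elem s C)
  dottedEntry-block s = cong₂ _,_
    (trans (cong length (nonzero-flag (elem s C) _ (positions-nonzero s w))) (length-positions s w))
    (elem0-flag (elem s C) _ (positions-nonzero s w))

typeC-↭ : ∀ C {w v} → w ↭ v → typeC C w ≡ typeC C v
typeC-↭ C {w} {v} w↭v rewrite indexSet-↭ C w↭v =
  List.map-cong (λ s → cong (_, elem s C) (count-↭ s w↭v)) (indexSet C v)

Isc-injective : ∀ C {w w′} → w ↭ w′ → Isc C w ≡ Isc C w′ → w ≡ w′
Isc-injective C {w} {w′} w↭w′ Isc≡ = positions-injective w w′ (indexSet-⊇ʳ C w) w′⊆S same-positions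
  where
  S = indexSet C w
  S≡ : indexSet C w′ ≡ S
  S≡ = sym (indexSet-↭ C w↭w′)
  w′⊆S : w′ ⊆ S
  w′⊆S = subst (w′ ⊆_) S≡ (indexSet-⊇ʳ C w′)
  same-blocks : map (block C w) S ≡ map (block C w′) S
  same-blocks =
    trans (sym (Isc-blocks C w)) (trans Isc≡ (trans (Isc-blocks C w′) (cong (map (block C w′)) S≡)))
  same-positions : ∀ {s} → s ∈ S → positions s w ≡ positions s w′
  same-positions {s} s∈ = List.++-cancelˡ (flag (elem s C) 0) _ _ (map-cong-local⁻ S same-blocks s∈)

MeetAtZero : List ℕ → List ℕ → Set
MeetAtZero B B′ = ∀ {x} → x ∈ B → x ∈ B′ → x ≡ 0

record BlockPartition (n : ℕ) (I : List (List ℕ)) : Set where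
  field
    strict : ∀ {B} → B ∈ I → AllPairs _<_ B
    disjoint : AllPairs MeetAtZero I
    bounded : ∀ {B} → B ∈ I → ∀ {x} → x ∈ B → x ≤ n
    covering : ∀ {x} → 1 ≤ x → x ≤ n → ∃[ B ] B ∈ I × x ∈ B

IsSetSupercomp⇒BlockPartition : ∀ {n k I} → IsSetSupercomp n k I → BlockPartition n I
IsSetSupercomp⇒BlockPartition {I = I} (nonempty-strict , disjoint , bounded , covering , _) = record
  { strict = λ B∈ → Incr⇒AllPairs (proj₁ (nonempty-strict _ B∈))
  ; disjoint = pairwise I disjoint
  ; bounded = λ B∈ x∈ → bounded (Any.index B∈) _ (subst (_ ∈_) (Any.lookup-index B∈) x∈)
  ; covering = λ {x} 1≤x x≤n → let i , x∈ = covering x 1≤x x≤n in lookup I i , ∈-lookup i , x∈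
  }
  where
  pairwise : ∀ I → (∀ (i j : Fin (length I)) → i ≢ j → ∀ x → x ∈ lookup I i → x ∈ lookup I j → x ≡ 0) →
    AllPairs MeetAtZero I
  pairwise [] _ = []
  pairwise (B ∷ I) disj =
    All.tabulate (λ B′∈ x∈B x∈B′ → disj Fin.zero (Fin.suc (Any.index B′∈)) (λ ()) _ x∈B
                                       (subst (_ ∈_) (Any.lookup-index B′∈) x∈B′)) ∷
    pairwise I (λ i j i≢j → disj (Fin.suc i) (Fin.suc j) (i≢j ∘ Fin.suc-injective))

label : List (ℕ × List ℕ) → ℕ → ℕ
label [] t = 0
label ((s , B) ∷ P) t = if elem t B then s else label P t

label-∈ : ∀ P {s B t} → AllPairs MeetAtZero (map proj₂ P) → (s , B) ∈ P → t ∈ B → t ≢ 0 → label P t ≡ s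
label-∈ ((s , B) ∷ P) {t = t} _ (here refl) t∈ _ = cong (λ b → if b then s else label P t) (elem-∈ t∈)
label-∈ ((s′ , B′) ∷ P) {t = t} (B′-meets ∷ disjoint) (there sB∈) t∈ t≢0 = trans
  (cong (λ b → if b then s′ else label P t)
        (elem-∉ B′ (λ t∈B′ → t≢0 (All.lookup B′-meets (∈-map⁺ proj₂ sB∈) t∈B′ t∈))))
  (label-∈ P disjoint sB∈ t∈ t≢0)

flag++nonzero : ∀ {B} → AllPairs _<_ B → flag (elem 0 B) 0 ++ nonzero B ≡ B
flag++nonzero {[]} _ = refl
flag++nonzero {zero ∷ B} (0<B ∷ _) = cong (0 ∷_) (List.filter-all _ (All.map ℕ.>⇒≢ 0<B))
flag++nonzero {suc x ∷ B} (x<B ∷ _) rewrite elem-∉ B (λ 0∈ → ℕ.<-asym (All.lookup x<B 0∈) (s≤s z≤n)) =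
  cong (suc x ∷_) (List.filter-all _ (All.map (λ x<y → ℕ.>⇒≢ (ℕ.<-trans (s≤s z≤n) x<y)) x<B))

-- Position t of the word carries the variable paired with the block containing t. Its
-- multiplicities are those of m, so it is a rearrangement of m without comparing n with length m.
module Decoding {n I} (blocks : BlockPartition n I) (C m : List ℕ) (type≡ : typeC C m ≡ α I) where

  open BlockPartition blocks

  S = indexSet C m
  P = zip S I

  |S|≡|I| : length S ≡ length I
  |S|≡|I| = trans (sym (List.length-map _ S)) (trans (cong length type≡) (List.length-map dottedEntry I))

  S≡ : map proj₁ P ≡ S
  S≡ = map-proj₁-zip S I |S|≡|I|

  I≡ : map proj₂ P ≡ I
  I≡ = map-proj₂-zip S I |S|≡|I|

  ∈S : ∀ {s B} → (s , B) ∈ P → s ∈ S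
  ∈S sB∈ = subst (_ ∈_) S≡ (∈-map⁺ proj₁ sB∈)

  ∈I : ∀ {s B} → (s , B) ∈ P → B ∈ I
  ∈I sB∈ = subst (_ ∈_) I≡ (∈-map⁺ proj₂ sB∈)

  paired-type : ∀ {s B} → (s , B) ∈ P → (count s m , elem s C) ≡ dottedEntry B
  paired-type = map-cong-local⁻ P (begin
    map (λ p → count (proj₁ p) m , elem (proj₁ p) C) P   ≡⟨ List.map-∘ P ⟩
    map (λ s → count s m , elem s C) (map proj₁ P)       ≡⟨ cong (map _) S≡ ⟩
    typeC C m                                            ≡⟨ type≡ ⟩
    map dottedEntry I                                    ≡⟨ cong (map dottedEntry) I≡ ⟨
    map dottedEntry (map proj₂ P)                        ≡⟨ List.map-∘ P ⟨
    map (dottedEntry ∘ proj₂) P                          ∎)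
    where open ≡-Reasoning

  unique-labels : Unique (map proj₁ P)
  unique-labels = subst Unique (sym S≡) (strict⇒unique (indexSet-strict C m))

  partner : ∀ {B} → B ∈ I → ∃[ s ] (s , B) ∈ P
  partner B∈ with ∈-map⁻ proj₂ (subst (_ ∈_) (sym I≡) B∈)
  ... | (s , _) , sB∈ , refl = s , sB∈

  partnerˡ : ∀ {s} → s ∈ S → ∃[ B ] (s , B) ∈ P
  partnerˡ s∈ with ∈-map⁻ proj₁ (subst (_ ∈_) (sym S≡) s∈)
  ... | (_ , B) , sB∈ , refl = B , sB∈

  decode : ℕ → ℕ
  decode = label P

  decode-∈ : ∀ {s B t} → (s , B) ∈ P → t ∈ B → t ≢ 0 → decode t ≡ s
  decode-∈ = label-∈ P (subst (AllPairs MeetAtZero) (sym I≡) disjoint)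

  decode-covers : ∀ {t} → t ∈ oneTo n → ∃[ s ] ∃[ B ] (s , B) ∈ P × t ∈ B × decode t ≡ s
  decode-covers t∈ with ∈-oneTo⁻ t∈
  ... | 1≤t , t≤n with covering 1≤t t≤n
  ...   | B , B∈ , t∈B with partner B∈
  ...     | s , sB∈ = s , B , sB∈ , t∈B , decode-∈ sB∈ t∈B (ℕ.>⇒≢ 1≤t)

  decode-fibre : ∀ {s B} → (s , B) ∈ P → filter (λ t → decode t ℕ.≟ s) (oneTo n) ≡ nonzero B
  decode-fibre {s} {B} sB∈ = strict-≡
    (AllPairs.filter⁺ (λ t → decode t ℕ.≟ s) (oneTo-strict n))
    (AllPairs.filter⁺ (λ x → ¬? (x ℕ.≟ 0)) (strict (∈I sB∈)))
    (mk⇔ to from)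
    where
    to : ∀ {t} → t ∈ filter (λ t → decode t ℕ.≟ s) (oneTo n) → t ∈ nonzero B
    to t∈ with ∈-filter⁻ (λ t → decode t ℕ.≟ s) t∈
    ... | t∈oneTo , decode≡s with decode-covers t∈oneTo
    ...   | s′ , B′ , s′B′∈ , t∈B′ , decode≡s′ with trans (sym decode≡s′) decode≡s
    ...     | refl with functional-pairs unique-labels sB∈ s′B′∈
    ...       | refl = ∈-filter⁺ (λ x → ¬? (x ℕ.≟ 0)) t∈B′ (ℕ.>⇒≢ (proj₁ (∈-oneTo⁻ t∈oneTo)))
    from : ∀ {t} → t ∈ nonzero B → t ∈ filter (λ t → decode t ℕ.≟ s) (oneTo n)
    from t∈ with ∈-filter⁻ (λ x → ¬? (x ℕ.≟ 0)) t∈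
    ... | t∈B , t≢0 = ∈-filter⁺ (λ t → decode t ℕ.≟ s)
      (∈-oneTo⁺ (ℕ.n≢0⇒n>0 t≢0) (bounded (∈I sB∈) t∈B)) (decode-∈ sB∈ t∈B t≢0)

  word : List ℕ
  word = map decode (oneTo n)

  positions-word : ∀ {s B} → (s , B) ∈ P → positions s word ≡ nonzero B
  positions-word {s} sB∈ = trans (positions-map-oneTo decode s n) (decode-fibre sB∈)

  count-word : ∀ x → count x word ≡ count x m
  count-word x with x ∈? S
  ... | yes x∈ = let B , xB∈ = partnerˡ x∈ in begin
    count x word               ≡⟨ length-positions x word ⟨
    length (positions x word)  ≡⟨ cong length (positions-word xB∈) ⟩
    length (nonzero B)         ≡⟨ cong proj₁ (paired-type xB∈) ⟨
    count x m                  ∎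
    where open ≡-Reasoning
  ... | no x∉ = begin
    count x word                                      ≡⟨ length-positions x word ⟨
    length (positions x word)                         ≡⟨ cong length (positions-map-oneTo decode x n) ⟩
    length (filter (λ t → decode t ℕ.≟ x) (oneTo n))
      ≡⟨ cong length (List.filter-none _ (All.tabulate decode≢x)) ⟩
    0                                                 ≡⟨ count-∉ m (x∉ ∘ indexSet-⊇ʳ C m) ⟨
    count x m                                         ∎
    where
    open ≡-Reasoning
    decode≢x : ∀ {t} → t ∈ oneTo n → decode t ≢ x
    decode≢x t∈ decode≡x with decode-covers t∈
    ... | s , _ , sB∈ , _ , decode≡s = x∉ (subst (_∈ S) (trans (sym decode≡s) decode≡x) (∈S sB∈))

  word-↭ : word ↭ m
  word-↭ = same-count⇒↭ word m count-word

  Isc-word : Isc C word ≡ I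
  Isc-word = begin
    Isc C word                              ≡⟨ Isc-blocks C word ⟩
    map (block C word) (indexSet C word)    ≡⟨ cong (map (block C word)) (indexSet-↭ C word-↭) ⟩
    map (block C word) S                    ≡⟨ cong (map (block C word)) S≡ ⟨
    map (block C word) (map proj₁ P)        ≡⟨ List.map-∘ P ⟨
    map (block C word ∘ proj₁) P            ≡⟨ List.map-cong-local (All.tabulate paired-block) ⟩
    map proj₂ P                             ≡⟨ I≡ ⟩
    I                                       ∎
    where
    open ≡-Reasoning
    paired-block : ∀ {p} → p ∈ P → block C word (proj₁ p) ≡ proj₂ p
    paired-block {s , B} sB∈ = begin
      flag (elem s C) 0 ++ positions s word
        ≡⟨ cong₂ (λ b Q → flag b 0 ++ Q) (cong proj₂ (paired-type sB∈)) (positions-word sB∈) ⟩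
      flag (elem 0 B) 0 ++ nonzero B
        ≡⟨ flag++nonzero (strict (∈I sB∈)) ⟩
      B ∎

-- The image of M_I

M-≡ : ∀ I C w → Isc C w ≡ I → M I C w ≡ 1ℚ
M-≡ I C w eq =
  cong (λ b → if b then 1ℚ else 0ℚ) (dec-true (List.≡-dec (List.≡-dec ℕ._≟_) (Isc C w) I) eq)

M-≢ : ∀ I C w → Isc C w ≢ I → M I C w ≡ 0ℚ
M-≢ I C w neq =
  cong (λ b → if b then 1ℚ else 0ℚ) (dec-false (List.≡-dec (List.≡-dec ℕ._≟_) (Isc C w) I) neq)

_≟ᵈ_ : (a b : DottedComp) → Dec (a ≡ b)
_≟ᵈ_ = List.≡-dec (Product.≡-dec ℕ._≟_ Bool._≟_)

-- The with-abstraction also evaluates Mc (α I) C m, to 0ℚ and 1ℚ in the two branches.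
abel-M : ∀ n k I → IsSetSupercomp n k I → abel (M I) ≈c Mc (α I)
abel-M n k I supercomp C m (_ , m-nondecr) with typeC C m ≟ᵈ α I
... | no type≢ = sumℚ-zero (M I C) (rearrangements m) (λ {w} w∈ → M-≢ I C w (type≢ ∘ wrong-type w∈))
  where
  wrong-type : ∀ {w} → w ∈ rearrangements m → Isc C w ≡ I → typeC C m ≡ α I
  wrong-type w∈ Isc≡ =
    trans (typeC-↭ C (↭-sym (rearrangement-↭ {m} w∈))) (trans (sym (α-Isc C _)) (cong α Isc≡))
... | yes type≡ =
  sumℚ-indicator (M I C) (rearrangements m) (Unique-rearrangements m)
    word∈ (M-≡ I C word Isc-word) other-words
  where
  open Decoding (IsSetSupercomp⇒BlockPartition supercomp) C m type≡
  word∈ : word ∈ rearrangements m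
  word∈ = ∈-rearrangements⁺ (trans (sortℕ-cong-↭ word-↭) (sortℕ-↗-id (NonDecr⇒Sorted m m-nondecr)))
  other-words : ∀ {w} → w ∈ rearrangements m → w ≢ word → M I C w ≡ 0ℚ
  other-words {w} w∈ w≢word = M-≢ I C w (λ Isc≡ → w≢word
    (Isc-injective C (↭-trans (rearrangement-↭ {m} w∈) (↭-sym word-↭)) (trans Isc≡ (sym Isc-word))))

proposition5p10 :
    (∀ f → sNCQSym f → sQSym (abel f)) ×
    (∀ f g → sNCQSym f → sNCQSym g → abel (f +ₙ g) ≈c (abel f +c abel g)) ×
    (∀ (c : ℚ) f → sNCQSym f → abel (c ·ₙ f) ≈c (c ·c abel f)) ×
    (abel oneₙ ≈c onec) ×
    (∀ f g → sNCQSym f → sNCQSym g → abel (f *ₙ g) ≈c (abel f *c abel g)) ×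
    (∀ n m I → IsSetSupercomp n m I → abel (M I) ≈c Mc (α I))
proposition5p10 =
  abel-sQSym ,
  (λ f g _ _ → abel-+ f g) ,
  (λ c f _ → abel-· c f) ,
  abel-one ,
  (λ f g _ _ → abel-* f g) ,
  abel-M
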